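{- Let $A\geq a\geq 1$ and $r\geq 1$ be integers, and let $Nmes_{r,A,a}$ be the set of overpartitions $\pi$ such that all parts of $\pi$ of size $\equiv a\pmod A$ and less than $mes_{r,A,a}(\pi)$ are non-overlined. Then \[ \sum_{\pi\in Nmes_{r,A,a}}z^{mes_{r,A,a}(\pi)}q^{|\pi|}=\frac{(-q;q)_{\infty}}{(q;q)_{\infty}}\sum_{k=0}^{\infty}z^{kA+a}\bigg[\frac{q^{r[A\binom{k}{2}+ka]}}{(-q^a;q^A)_k}-\frac{2 q^{r[A\binom{k+1}{2}+(k+1)a]}}{(-q^a;q^A)_{k+1}}\bigg]. \]
   Context: An overpartition is a partition (finite non-increasing sequence of positive integers) in which the first occurrence of each part value may be overlined; $|\pi|$ is the sum of parts. A part is of size $t$ if it equals $t$ or $\overline{t}$. $(a;q)_\infty=\prod_{i\geq0}(1-aq^i)$, $(a;q)_n=(a;q)_\infty/(aq^n;q)_\infty$; $|q|<1$, $z$ a formal variable. For $r\geq1$, $mes_{r,A,a}(\pi)$ is the smallest positive integer $\equiv a\pmod A$ such that there are fewer than $r$ parts of size $mes_{r,A,a}(\pi)$ in $\pi$. -}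

module Defs where

open import Data.Nat as ℕ using (ℕ; zero; suc; _≤_; _<_; _∸_; _≡ᵇ_; _≟_)
open import Data.Nat.Combinatorics using (_C_)
open import Data.Integer as ℤ using (ℤ; +_; -_; -1ℤ; 1ℤ; 0ℤ)
open import Data.Integer.Divisibility using (_∣_)
open import Data.Bool using (Bool; true; false; if_then_else_)
open import Data.Product using (_×_; _,_; proj₁; proj₂)
open import Data.Sum using (_⊎_)
open import Data.List using (List; []; _∷_; length; filter; map)
open import Data.Nat.ListAction using (sum)
open import Data.List.Relation.Unary.All using (All)
open import Data.List.Relation.Unary.Linked using (Linked)
open import Data.List.Membership.Propositional using (_∈_)
open import Relation.Binary.PropositionalEquality using (_≡_)

-- A part is a pair (t , o): its size t and whether it is overlined (o = true).
Part : Set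
Part = ℕ × Bool

-- Two consecutive parts (t , o) then (t' , o') of an overpartition:
-- either t' < t, or t' = t and the later one is not overlined
-- (only the first occurrence of a value may be overlined).
Step : Part → Part → Set
Step (t , o) (t' , o') = t' ℕ.< t ⊎ (t' ≡ t × o' ≡ false)

IsOverpartition : List Part → Set
IsOverpartition π = All (λ p → 1 ℕ.≤ proj₁ p) π × Linked Step π

weight : List Part → ℕ
weight π = sum (map proj₁ π)

count : List Part → ℕ → ℕ
count π t = length (filter (λ p → proj₁ p ≟ t) π)

CongMod : ℕ → ℕ → ℕ → Set
CongMod A x y = (+ A) ∣ (+ x ℤ.- + y)

-- m = mes_{r,A,a}(π): m is the smallest positive integer ≡ a (mod A)
-- with fewer than r parts of size m.
IsMes : ℕ → ℕ → ℕ → List Part → ℕ → Set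
IsMes r A a π m =
  1 ℕ.≤ m × CongMod A m a × count π m ℕ.< r ×
  (∀ m' → 1 ℕ.≤ m' → CongMod A m' a → m' ℕ.< m → r ℕ.≤ count π m')

-- all parts of size ≡ a (mod A) and less than m are non-overlined
-- (with m = mes(π) this is the membership condition for Nmes_{r,A,a})
NmesCond : ℕ → ℕ → List Part → ℕ → Set
NmesCond A a π m =
  ∀ p → p ∈ π → CongMod A (proj₁ p) a → proj₁ p ℕ.< m → proj₂ p ≡ false

PS : Set
PS = ℕ → ℤ

sumBelow : ℕ → (ℕ → ℤ) → ℤ
sumBelow zero    f = 0ℤ
sumBelow (suc n) f = sumBelow n f ℤ.+ f n

_⊕_ : PS → PS → PS
(f ⊕ g) n = f n ℤ.+ g n

_⊖_ : PS → PS → PS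
(f ⊖ g) n = f n ℤ.- g n

_·_ : ℤ → PS → PS
(c · f) n = c ℤ.* f n

_⊛_ : PS → PS → PS
(f ⊛ g) n = sumBelow (suc n) (λ i → f i ℤ.* g (n ∸ i))

mono : ℕ → PS
mono e n = if e ≡ᵇ n then 1ℤ else 0ℤ

one : PS
one = mono 0

-- 1 / (1 - c q^m) = Σ_j c^j q^{jm}   (used only with m ≥ 1)
geom : ℤ → ℕ → PS
geom c m n = sumBelow (suc n) (λ j → if (j ℕ.* m) ≡ᵇ n then c ℤ.^ j else 0ℤ)

prodBelow : ℕ → (ℕ → PS) → PS
prodBelow zero    f = one
prodBelow (suc k) f = prodBelow k f ⊛ f k

-- (-q;q)_∞ / (q;q)_∞ = Π_{i≥1} (1 + q^i)/(1 - q^i); factor i is 1 + O(q^i),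
-- so the n-th coefficient of the infinite product is that of Π_{i=1}^{n}.
overFactor : ℕ → PS
overFactor i = (one ⊕ mono i) ⊛ geom 1ℤ i

overGF : PS
overGF n = prodBelow n (λ j → overFactor (suc j)) n

-- 1 / (-q^a; q^A)_k = Π_{j<k} 1/(1 + q^{a + jA})
invPoch : ℕ → ℕ → ℕ → PS
invPoch A a k = prodBelow k (λ j → geom -1ℤ (a ℕ.+ j ℕ.* A))

bracket : ℕ → ℕ → ℕ → ℕ → PS
bracket r A a k =
  (mono (r ℕ.* (A ℕ.* (k C 2) ℕ.+ k ℕ.* a)) ⊛ invPoch A a k)
  ⊖ ((+ 2) · (mono (r ℕ.* (A ℕ.* (suc k C 2) ℕ.+ suc k ℕ.* a)) ⊛ invPoch A a (suc k)))

-- coefficient of z^m q^n in the right-hand side.  Only k with kA + a = m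
-- contribute to z^m; since A ≥ 1 such k satisfy k ≤ m.
rhsCoeff : ℕ → ℕ → ℕ → ℕ → ℕ → ℤ
rhsCoeff r A a m n =
  sumBelow (suc m) (λ k → if (k ℕ.* A ℕ.+ a) ≡ᵇ m then (overGF ⊛ bracket r A a k) n else 0ℤ)

-- Write m = k A + a. An overpartition lies in Nmes with mes = m exactly when each size
-- i A + a (i < k) occurs at least r times and is never overlined, the size m occurs fewer
-- than r times, and every other size is unconstrained. The generating function therefore
-- factors over the sizes t: a free size gives (1 + q^t)/(1 - q^t), a size i A + a below m
-- gives q^(rt)/(1 - q^t) = (1 + q^t)/(1 - q^t) · q^(rt)/(1 + q^t), and m gives
-- (1 + q^m)/(1 - q^m) - 2 q^(rm)/(1 - q^m). After pulling out (-q;q)∞/(q;q)∞ the remaining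
-- factors telescope to q^(r[A binom(k,2) + k a])/(-q^a;q^A)_k · (1 - 2 q^(rm)/(1 + q^m)),
-- the k-th bracket. Enumerating overpartitions block of largest parts first makes the
-- number of those of weight n the n-th coefficient of the product of the per-size series;
-- parts larger than n cannot occur, which truncates the infinite products.

module Submission where

open import Defs
open import Data.Bool using (Bool; true; false; if_then_else_)
open import Data.Bool.Properties using (T-≡)
open import Data.Empty using (⊥; ⊥-elim)
open import Data.Integer as ℤ using (ℤ; +_; 0ℤ; 1ℤ; -1ℤ; -_)
import Data.Integer.Properties as ℤₚ
import Data.Integer.Solver as ℤSolver
open import Data.List using (List; []; _∷_; _++_; length; map; replicate; filter; concatMap)
import Data.List.Properties as Listₚ
open import Data.List.Membership.Propositional using (_∈_; find; lose)
open import Data.List.Membership.Propositional.Properties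
  using (∈-++⁻; ∈-++⁺ˡ; ∈-++⁺ʳ; ∈-map⁺; ∈-map⁻; ∈-concatMap⁺; ∈-concatMap⁻)
open import Data.List.Relation.Unary.All as All using (All; []; _∷_)
import Data.List.Relation.Unary.All.Properties as Allₚ
open import Data.List.Relation.Unary.AllPairs using ([]; _∷_)
open import Data.List.Relation.Unary.Any using (here; there)
open import Data.List.Relation.Unary.Linked as Linked using (Linked; []; [-]; _∷_)
open import Data.List.Relation.Unary.Unique.Propositional using (Unique)
import Data.List.Relation.Unary.Unique.Propositional.Properties as Uniqueₚ
open import Data.Nat as ℕ
  using (ℕ; zero; suc; _+_; _*_; _∸_; _≤_; _<_; _≡ᵇ_; z≤n; s≤s; NonZero; _≟_; _≤?_; _<?_)
import Data.Nat.Properties as ℕₚ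
open import Data.Nat.Combinatorics using (_C_; nC1≡n; nCk+nC[k+1]≡[n+1]C[k+1])
open import Data.Nat.Divisibility using (divides)
open import Data.Nat.DivMod using (_%_; _/_; m≡m%n+[m/n]*n; m*n%n≡0)
open import Data.Nat.ListAction using (sum)
open import Data.Nat.ListAction.Properties using (sum-++)
import Data.Nat.Solver as ℕSolver
open import Data.Product using (_×_; _,_; proj₁; proj₂; ∃)
open import Data.Sum using (inj₁; inj₂)
open import Data.Unit using (⊤; tt)
open import Function using (case_of_)
open import Function.Bundles using (_⇔_; mk⇔; module Equivalence)
open import Relation.Binary.Bundles using (Setoid)
open import Relation.Binary.PropositionalEquality
import Relation.Binary.Reasoning.Setoid as SetoidReasoning
open import Relation.Nullary using (¬_; yes; no)

module ≗-Reasoning = SetoidReasoning (ℕ →-setoid ℤ)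
open Setoid (ℕ →-setoid ℤ) using () renaming (refl to ≗-refl; sym to ≗-sym; trans to ≗-trans)

≡ᵇ-true⇒≡ : ∀ {m n} → (m ≡ᵇ n) ≡ true → m ≡ n
≡ᵇ-true⇒≡ {m} {n} e = ℕₚ.≡ᵇ⇒≡ m n (Equivalence.from T-≡ e)

≡⇒≡ᵇ-true : ∀ {m n} → m ≡ n → (m ≡ᵇ n) ≡ true
≡⇒≡ᵇ-true {m} {n} e = Equivalence.to T-≡ (ℕₚ.≡⇒≡ᵇ m n e)

≢⇒≡ᵇ-false : ∀ {m n} → m ≢ n → (m ≡ᵇ n) ≡ false
≢⇒≡ᵇ-false {m} {n} m≢n with m ≡ᵇ n in e
... | false = refl
... | true  = ⊥-elim (m≢n (≡ᵇ-true⇒≡ e))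

sumBelow-cong : ∀ n {f g : ℕ → ℤ} → (∀ i → i < n → f i ≡ g i) → sumBelow n f ≡ sumBelow n g
sumBelow-cong zero    f≡g = refl
sumBelow-cong (suc n) f≡g =
  cong₂ ℤ._+_ (sumBelow-cong n (λ i i<n → f≡g i (ℕₚ.m<n⇒m<1+n i<n))) (f≡g n ℕₚ.≤-refl)

sumBelow-+ : ∀ n (f g : ℕ → ℤ) → sumBelow n (λ i → f i ℤ.+ g i) ≡ sumBelow n f ℤ.+ sumBelow n g
sumBelow-+ zero    f g = refl
sumBelow-+ (suc n) f g = trans (cong (ℤ._+ (f n ℤ.+ g n)) (sumBelow-+ n f g))
  (solve 4 (λ a b c d → (a :+ b) :+ (c :+ d) := (a :+ c) :+ (b :+ d)) refl
    (sumBelow n f) (sumBelow n g) (f n) (g n))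
  where open ℤSolver.+-*-Solver

sumBelow-neg : ∀ n (f : ℕ → ℤ) → sumBelow n (λ i → - f i) ≡ - sumBelow n f
sumBelow-neg zero    f = refl
sumBelow-neg (suc n) f = trans (cong (ℤ._+ (- f n)) (sumBelow-neg n f))
  (sym (ℤₚ.neg-distrib-+ (sumBelow n f) (f n)))

*-distribˡ-sumBelow : ∀ n c (f : ℕ → ℤ) → c ℤ.* sumBelow n f ≡ sumBelow n (λ i → c ℤ.* f i)
*-distribˡ-sumBelow zero    c f = ℤₚ.*-zeroʳ c
*-distribˡ-sumBelow (suc n) c f = trans (ℤₚ.*-distribˡ-+ c (sumBelow n f) (f n))
  (cong (ℤ._+ (c ℤ.* f n)) (*-distribˡ-sumBelow n c f))

*-distribʳ-sumBelow : ∀ n c (f : ℕ → ℤ) → sumBelow n f ℤ.* c ≡ sumBelow n (λ i → f i ℤ.* c)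
*-distribʳ-sumBelow n c f = trans (ℤₚ.*-comm (sumBelow n f) c)
  (trans (*-distribˡ-sumBelow n c f) (sumBelow-cong n (λ i _ → ℤₚ.*-comm c (f i))))

sumBelow-zero : ∀ n → sumBelow n (λ _ → 0ℤ) ≡ 0ℤ
sumBelow-zero zero    = refl
sumBelow-zero (suc n) = trans (ℤₚ.+-identityʳ _) (sumBelow-zero n)

sumBelow-suc : ∀ n (f : ℕ → ℤ) → sumBelow (suc n) f ≡ f 0 ℤ.+ sumBelow n (λ i → f (suc i))
sumBelow-suc zero    f = trans (ℤₚ.+-identityˡ (f 0)) (sym (ℤₚ.+-identityʳ (f 0)))
sumBelow-suc (suc n) f = trans (cong (ℤ._+ f (suc n)) (sumBelow-suc n f))
  (ℤₚ.+-assoc (f 0) (sumBelow n (λ i → f (suc i))) (f (suc n)))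

sumBelow-reverse : ∀ n (f : ℕ → ℤ) → sumBelow n f ≡ sumBelow n (λ i → f (n ∸ suc i))
sumBelow-reverse zero    f = refl
sumBelow-reverse (suc n) f = trans (cong (ℤ._+ f n) (sumBelow-reverse n f))
  (trans (ℤₚ.+-comm _ (f n)) (sym (sumBelow-suc n (λ i → f (suc n ∸ suc i)))))

sumBelow-triangle : ∀ n (F : ℕ → ℕ → ℤ) →
  sumBelow (suc n) (λ i → sumBelow (suc i) (λ j → F j i)) ≡
  sumBelow (suc n) (λ j → sumBelow (suc (n ∸ j)) (λ l → F j (j + l)))
sumBelow-triangle zero    F = refl
sumBelow-triangle (suc n) F = begin
    Lₙ ℤ.+ (Σcol ℤ.+ F (suc n) (suc n))
  ≡⟨ cong (λ x → x ℤ.+ (Σcol ℤ.+ F (suc n) (suc n))) (sumBelow-triangle n F) ⟩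
    Rₙ ℤ.+ (Σcol ℤ.+ F (suc n) (suc n))
  ≡⟨ sym (ℤₚ.+-assoc Rₙ Σcol _) ⟩
    (Rₙ ℤ.+ Σcol) ℤ.+ F (suc n) (suc n)
  ≡⟨ cong₂ ℤ._+_ (sym (sumBelow-+ (suc n) _ _)) (cong (F (suc n)) (sym (ℕₚ.+-identityʳ (suc n)))) ⟩
    sumBelow (suc n) (λ j → row n j ℤ.+ F j (suc n)) ℤ.+ F (suc n) (suc n + 0)
  ≡⟨ cong₂ ℤ._+_ (sumBelow-cong (suc n) extend-row) (sym (ℤₚ.+-identityˡ _)) ⟩
    sumBelow (suc n) (row (suc n)) ℤ.+ (0ℤ ℤ.+ F (suc n) (suc n + 0))
  ≡⟨ cong (λ d → sumBelow (suc n) (row (suc n)) ℤ.+ sumBelow (suc d) (λ l → F (suc n) (suc n + l)))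
       (sym (ℕₚ.n∸n≡0 n)) ⟩
    sumBelow (suc (suc n)) (row (suc n))
  ∎
  where
  open ≡-Reasoning
  row : ℕ → ℕ → ℤ
  row n j = sumBelow (suc (n ∸ j)) (λ l → F j (j + l))
  Lₙ   = sumBelow (suc n) (λ i → sumBelow (suc i) (λ j → F j i))
  Rₙ   = sumBelow (suc n) (row n)
  Σcol = sumBelow (suc n) (λ j → F j (suc n))
  extend-row : ∀ j → j < suc n → row n j ℤ.+ F j (suc n) ≡ row (suc n) j
  extend-row j (s≤s j≤n) = begin
      row n j ℤ.+ F j (suc n)
    ≡⟨ cong (λ x → row n j ℤ.+ F j x)
         (sym (trans (ℕₚ.+-suc j (n ∸ j)) (cong suc (ℕₚ.m+[n∸m]≡n j≤n)))) ⟩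
      sumBelow (suc (suc (n ∸ j))) (λ l → F j (j + l))
    ≡⟨ cong (λ d → sumBelow (suc d) (λ l → F j (j + l))) (sym (ℕₚ.+-∸-assoc 1 j≤n)) ⟩
      row (suc n) j
    ∎

sumBelow-if-none : ∀ n (P : ℕ → Bool) (g : ℕ → ℤ) → (∀ i → i < n → P i ≡ false) →
  sumBelow n (λ i → if P i then g i else 0ℤ) ≡ 0ℤ
sumBelow-if-none zero    P g ¬P = refl
sumBelow-if-none (suc n) P g ¬P rewrite ¬P n ℕₚ.≤-refl =
  trans (ℤₚ.+-identityʳ _) (sumBelow-if-none n P g (λ i i<n → ¬P i (ℕₚ.m<n⇒m<1+n i<n)))

sumBelow-if-unique : ∀ n (P : ℕ → Bool) (g : ℕ → ℤ) j → j < n → P j ≡ true →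
  (∀ i → i < n → P i ≡ true → i ≡ j) →
  sumBelow n (λ i → if P i then g i else 0ℤ) ≡ g j
sumBelow-if-unique (suc n) P g j j<1+n Pj only-j with ℕₚ.m≤n⇒m<n∨m≡n (ℕₚ.≤-pred j<1+n)
... | inj₁ j<n = begin
    Σₙ ℤ.+ (if P n then g n else 0ℤ)  ≡⟨ cong (λ x → Σₙ ℤ.+ x) ¬Pn ⟩
    Σₙ ℤ.+ 0ℤ                          ≡⟨ ℤₚ.+-identityʳ Σₙ ⟩
    Σₙ                                 ≡⟨ sumBelow-if-unique n P g j j<n Pj (λ i i<n → only-j i (ℕₚ.m<n⇒m<1+n i<n)) ⟩
    g j                                ∎
  where
  open ≡-Reasoning
  Σₙ = sumBelow n (λ i → if P i then g i else 0ℤ)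
  ¬Pn : (if P n then g n else 0ℤ) ≡ 0ℤ
  ¬Pn with P n in Pn
  ... | false = refl
  ... | true  = ⊥-elim (ℕₚ.<-irrefl (sym (only-j n ℕₚ.≤-refl Pn)) j<n)
... | inj₂ refl rewrite Pj =
  trans (cong (ℤ._+ g j) (sumBelow-if-none j P g ¬P)) (ℤₚ.+-identityˡ (g j))
  where
  ¬P : ∀ i → i < j → P i ≡ false
  ¬P i i<j with P i in Pi
  ... | false = refl
  ... | true  = ⊥-elim (ℕₚ.<-irrefl (only-j i (ℕₚ.m<n⇒m<1+n i<j) Pi) i<j)

⊛-cong : ∀ {f f′ g g′} → f ≗ f′ → g ≗ g′ → (f ⊛ g) ≗ (f′ ⊛ g′)
⊛-cong f≗f′ g≗g′ n = sumBelow-cong (suc n) (λ i _ → cong₂ ℤ._*_ (f≗f′ i) (g≗g′ (n ∸ i)))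

⊛-congˡ : ∀ f {g g′} → g ≗ g′ → (f ⊛ g) ≗ (f ⊛ g′)
⊛-congˡ f = ⊛-cong {f} (λ _ → refl)

⊛-congʳ : ∀ g {f f′} → f ≗ f′ → (f ⊛ g) ≗ (f′ ⊛ g)
⊛-congʳ g f≗f′ = ⊛-cong {g = g} f≗f′ (λ _ → refl)

⊖-cong : ∀ {f f′ g g′} → f ≗ f′ → g ≗ g′ → (f ⊖ g) ≗ (f′ ⊖ g′)
⊖-cong f≗f′ g≗g′ n = cong₂ ℤ._-_ (f≗f′ n) (g≗g′ n)

·-congˡ : ∀ c {f f′} → f ≗ f′ → (c · f) ≗ (c · f′)
·-congˡ c f≗f′ n = cong (c ℤ.*_) (f≗f′ n)

⊛-comm : ∀ f g → (f ⊛ g) ≗ (g ⊛ f)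
⊛-comm f g n = trans (sumBelow-reverse (suc n) (λ i → f i ℤ.* g (n ∸ i)))
  (sumBelow-cong (suc n) λ i i<1+n →
    trans (cong (λ x → f (n ∸ i) ℤ.* g x) (ℕₚ.m∸[m∸n]≡n (ℕₚ.≤-pred i<1+n)))
          (ℤₚ.*-comm (f (n ∸ i)) (g i)))

⊛-assoc : ∀ f g h → ((f ⊛ g) ⊛ h) ≗ (f ⊛ (g ⊛ h))
⊛-assoc f g h n = begin
    sumBelow (suc n) (λ i → sumBelow (suc i) (λ j → f j ℤ.* g (i ∸ j)) ℤ.* h (n ∸ i))
  ≡⟨ sumBelow-cong (suc n) (λ i _ → *-distribʳ-sumBelow (suc i) (h (n ∸ i)) _) ⟩
    sumBelow (suc n) (λ i → sumBelow (suc i) (λ j → f j ℤ.* g (i ∸ j) ℤ.* h (n ∸ i)))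
  ≡⟨ sumBelow-triangle n (λ j i → f j ℤ.* g (i ∸ j) ℤ.* h (n ∸ i)) ⟩
    sumBelow (suc n) (λ j → sumBelow (suc (n ∸ j)) (λ l → f j ℤ.* g (j + l ∸ j) ℤ.* h (n ∸ (j + l))))
  ≡⟨ sumBelow-cong (suc n) (λ j _ → trans (sumBelow-cong (suc (n ∸ j)) (λ l _ → reindex j l))
       (sym (*-distribˡ-sumBelow (suc (n ∸ j)) (f j) _))) ⟩
    sumBelow (suc n) (λ j → f j ℤ.* sumBelow (suc (n ∸ j)) (λ l → g l ℤ.* h (n ∸ j ∸ l)))
  ∎
  where
  open ≡-Reasoning
  reindex : ∀ j l → f j ℤ.* g (j + l ∸ j) ℤ.* h (n ∸ (j + l)) ≡ f j ℤ.* (g l ℤ.* h (n ∸ j ∸ l))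
  reindex j l = trans (cong₂ (λ x y → f j ℤ.* g x ℤ.* h y) (ℕₚ.m+n∸m≡n j l) (sym (ℕₚ.∸-+-assoc n j l)))
                      (ℤₚ.*-assoc (f j) (g l) (h (n ∸ j ∸ l)))

⊛-distribʳ-⊕ : ∀ f g h → ((f ⊕ g) ⊛ h) ≗ ((f ⊛ h) ⊕ (g ⊛ h))
⊛-distribʳ-⊕ f g h n = trans (sumBelow-cong (suc n) (λ i _ → ℤₚ.*-distribʳ-+ (h (n ∸ i)) (f i) (g i)))
  (sumBelow-+ (suc n) _ _)

⊛-distribʳ-⊖ : ∀ f g h → ((f ⊖ g) ⊛ h) ≗ ((f ⊛ h) ⊖ (g ⊛ h))
⊛-distribʳ-⊖ f g h n =
  trans (sumBelow-cong (suc n) (λ i _ → trans (ℤₚ.*-distribʳ-+ (h (n ∸ i)) (f i) (- g i))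
          (cong (λ x → f i ℤ.* h (n ∸ i) ℤ.+ x) (sym (ℤₚ.neg-distribˡ-* (g i) (h (n ∸ i)))))))
  (trans (sumBelow-+ (suc n) _ _) (cong (λ x → (f ⊛ h) n ℤ.+ x) (sumBelow-neg (suc n) _)))

⊛-distribˡ-⊖ : ∀ f g h → (f ⊛ (g ⊖ h)) ≗ ((f ⊛ g) ⊖ (f ⊛ h))
⊛-distribˡ-⊖ f g h = begin
  f ⊛ (g ⊖ h)           ≈⟨ ⊛-comm f (g ⊖ h) ⟩
  (g ⊖ h) ⊛ f           ≈⟨ ⊛-distribʳ-⊖ g h f ⟩
  (g ⊛ f) ⊖ (h ⊛ f)     ≈⟨ ⊖-cong (⊛-comm g f) (⊛-comm h f) ⟩
  (f ⊛ g) ⊖ (f ⊛ h)     ∎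
  where open ≗-Reasoning

⊛-·ʳ : ∀ c f g → (f ⊛ (c · g)) ≗ (c · (f ⊛ g))
⊛-·ʳ c f g n = trans (sumBelow-cong (suc n) (λ i _ → shuffle (f i) (g (n ∸ i))))
  (sym (*-distribˡ-sumBelow (suc n) c _))
  where
  shuffle : ∀ x y → x ℤ.* (c ℤ.* y) ≡ c ℤ.* (x ℤ.* y)
  shuffle x y = trans (sym (ℤₚ.*-assoc x c y))
    (trans (cong (ℤ._* y) (ℤₚ.*-comm x c)) (ℤₚ.*-assoc c x y))

⊛-interchange : ∀ f g h k → ((f ⊛ g) ⊛ (h ⊛ k)) ≗ ((f ⊛ h) ⊛ (g ⊛ k))
⊛-interchange f g h k = begin
  (f ⊛ g) ⊛ (h ⊛ k)   ≈⟨ ⊛-assoc f g (h ⊛ k) ⟩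
  f ⊛ (g ⊛ (h ⊛ k))   ≈⟨ ⊛-congˡ f (≗-sym (⊛-assoc g h k)) ⟩
  f ⊛ ((g ⊛ h) ⊛ k)   ≈⟨ ⊛-congˡ f (⊛-congʳ k (⊛-comm g h)) ⟩
  f ⊛ ((h ⊛ g) ⊛ k)   ≈⟨ ⊛-congˡ f (⊛-assoc h g k) ⟩
  f ⊛ (h ⊛ (g ⊛ k))   ≈⟨ ≗-sym (⊛-assoc f h (g ⊛ k)) ⟩
  (f ⊛ h) ⊛ (g ⊛ k)   ∎
  where open ≗-Reasoning

if-*ˡ : ∀ (b : Bool) x → (if b then 1ℤ else 0ℤ) ℤ.* x ≡ (if b then x else 0ℤ)
if-*ˡ true  x = ℤₚ.*-identityˡ x
if-*ˡ false x = refl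

mono-⊛-shift : ∀ e d f → (mono e ⊛ f) (e + d) ≡ f d
mono-⊛-shift e d f =
  trans (sumBelow-cong (suc (e + d)) (λ i _ → if-*ˡ (e ≡ᵇ i) (f (e + d ∸ i))))
  (trans (sumBelow-if-unique (suc (e + d)) (e ≡ᵇ_) (λ i → f (e + d ∸ i)) e
           (s≤s (ℕₚ.m≤m+n e d)) (≡⇒≡ᵇ-true {e} refl) (λ i _ e≡i → sym (≡ᵇ-true⇒≡ e≡i)))
         (cong f (ℕₚ.m+n∸m≡n e d)))

mono-⊛-below : ∀ e w f → w < e → (mono e ⊛ f) w ≡ 0ℤ
mono-⊛-below e w f w<e =
  trans (sumBelow-cong (suc w) (λ i _ → if-*ˡ (e ≡ᵇ i) (f (w ∸ i))))
        (sumBelow-if-none (suc w) (e ≡ᵇ_) _ (λ i i<1+w → ≢⇒≡ᵇ-false (e≢i i<1+w)))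
  where
  e≢i : ∀ {i} → i < suc w → e ≢ i
  e≢i i≤w refl = ℕₚ.<-irrefl refl (ℕₚ.<-≤-trans w<e (ℕₚ.≤-pred i≤w))

⊛-identityˡ : ∀ f → (one ⊛ f) ≗ f
⊛-identityˡ f n = mono-⊛-shift 0 n f

⊛-identityʳ : ∀ f → (f ⊛ one) ≗ f
⊛-identityʳ f = ≗-trans (⊛-comm f one) (⊛-identityˡ f)

mono-+ : ∀ e e′ → (mono e ⊛ mono e′) ≗ mono (e + e′)
mono-+ e e′ n with ℕₚ.<-≤-connex n e
... | inj₁ n<e = trans (mono-⊛-below e n (mono e′) n<e)
                       (sym (cong (if_then 1ℤ else 0ℤ) (≢⇒≡ᵇ-false e+e′≢n)))
  where
  e+e′≢n : e + e′ ≢ n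
  e+e′≢n e+e′≡n = ℕₚ.<-irrefl refl (ℕₚ.<-≤-trans n<e (subst (e ≤_) e+e′≡n (ℕₚ.m≤m+n e e′)))
... | inj₂ e≤n = begin
    (mono e ⊛ mono e′) n              ≡⟨ cong (mono e ⊛ mono e′) (sym (ℕₚ.m+[n∸m]≡n e≤n)) ⟩
    (mono e ⊛ mono e′) (e + (n ∸ e))  ≡⟨ mono-⊛-shift e (n ∸ e) (mono e′) ⟩
    mono e′ (n ∸ e)                   ≡⟨ mono-+ˡ e ⟩
    mono (e + e′) (e + (n ∸ e))       ≡⟨ cong (mono (e + e′)) (ℕₚ.m+[n∸m]≡n e≤n) ⟩
    mono (e + e′) n                   ∎
  where
  open ≡-Reasoning
  mono-+ˡ : ∀ c → mono e′ (n ∸ e) ≡ mono (c + e′) (c + (n ∸ e))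
  mono-+ˡ zero    = refl
  mono-+ˡ (suc c) = mono-+ˡ c

inPowers : ℕ → (ℕ → ℤ) → PS
inPowers t x n = sumBelow (suc n) (λ j → if j * t ≡ᵇ n then x j else 0ℤ)

record InPowersOf (t : ℕ) (f : PS) (v : ℕ → ℤ) : Set where
  field
    at-multiple  : ∀ j → f (j * t) ≡ v j
    off-multiple : ∀ w → (∀ j → j * t ≢ w) → f w ≡ 0ℤ

open InPowersOf

inPowersOf-unique : ∀ t .{{_ : NonZero t}} {f g v u} →
  InPowersOf t f v → InPowersOf t g u → v ≗ u → f ≗ g
inPowersOf-unique t {f} {g} pf pg v≗u w with w % t ℕ.≟ 0
... | yes w%t≡0 = subst (λ x → f x ≡ g x) w/t*t≡w
      (trans (at-multiple pf (w / t)) (trans (v≗u (w / t)) (sym (at-multiple pg (w / t)))))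
  where
  w/t*t≡w : (w / t) * t ≡ w
  w/t*t≡w = sym (trans (m≡m%n+[m/n]*n w t) (cong (_+ (w / t) * t) w%t≡0))
... | no w%t≢0 = trans (off-multiple pf w not-multiple) (sym (off-multiple pg w not-multiple))
  where
  not-multiple : ∀ j → j * t ≢ w
  not-multiple j j*t≡w = w%t≢0 (subst (λ x → x % t ≡ 0) j*t≡w (m*n%n≡0 j t))

inPowersOf-resp : ∀ {t f g v} → f ≗ g → InPowersOf t f v → InPowersOf t g v
inPowersOf-resp f≗g p .at-multiple  j      = trans (sym (f≗g _)) (at-multiple p j)
inPowersOf-resp f≗g p .off-multiple w ¬mul = trans (sym (f≗g w)) (off-multiple p w ¬mul)

inPowersOf-⊕ : ∀ {t f g v u} → InPowersOf t f v → InPowersOf t g u →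
  InPowersOf t (f ⊕ g) (λ j → v j ℤ.+ u j)
inPowersOf-⊕ p q .at-multiple  j      = cong₂ ℤ._+_ (at-multiple p j) (at-multiple q j)
inPowersOf-⊕ p q .off-multiple w ¬mul = cong₂ ℤ._+_ (off-multiple p w ¬mul) (off-multiple q w ¬mul)

inPowersOf-⊖ : ∀ {t f g v u} → InPowersOf t f v → InPowersOf t g u →
  InPowersOf t (f ⊖ g) (λ j → v j ℤ.- u j)
inPowersOf-⊖ p q .at-multiple  j      = cong₂ ℤ._-_ (at-multiple p j) (at-multiple q j)
inPowersOf-⊖ p q .off-multiple w ¬mul = cong₂ ℤ._-_ (off-multiple p w ¬mul) (off-multiple q w ¬mul)

inPowersOf-· : ∀ {t f v} c → InPowersOf t f v → InPowersOf t (c · f) (λ j → c ℤ.* v j)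
inPowersOf-· c p .at-multiple  j      = cong (c ℤ.*_) (at-multiple p j)
inPowersOf-· c p .off-multiple w ¬mul = trans (cong (c ℤ.*_) (off-multiple p w ¬mul)) (ℤₚ.*-zeroʳ c)

inPowers-inPowersOf : ∀ t .{{_ : NonZero t}} x → InPowersOf t (inPowers t x) x
inPowers-inPowersOf t x .at-multiple j =
  sumBelow-if-unique (suc (j * t)) (λ i → i * t ≡ᵇ j * t) x j (s≤s (ℕₚ.m≤m*n j t))
    (≡⇒≡ᵇ-true {j * t} refl) (λ i _ i*t≡j*t → ℕₚ.*-cancelʳ-≡ i j t (≡ᵇ-true⇒≡ i*t≡j*t))
inPowers-inPowersOf t x .off-multiple w ¬mul =
  sumBelow-if-none (suc w) (λ i → i * t ≡ᵇ w) x (λ i _ → ≢⇒≡ᵇ-false (¬mul i))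

one-inPowersOf : ∀ t .{{_ : NonZero t}} → InPowersOf t one (0ℤ ℤ.^_)
one-inPowersOf t .at-multiple zero    = refl
one-inPowersOf t .at-multiple (suc j) =
  trans (cong (if_then 1ℤ else 0ℤ) (≢⇒≡ᵇ-false 0≢t+j*t)) (sym (ℤₚ.*-zeroˡ (0ℤ ℤ.^ j)))
  where
  0≢t+j*t : 0 ≢ t + j * t
  0≢t+j*t 0≡t+j*t = ℕₚ.<-irrefl 0≡t+j*t (ℕₚ.<-≤-trans (ℕ.>-nonZero⁻¹ t) (ℕₚ.m≤m+n t (j * t)))
one-inPowersOf t .off-multiple w ¬mul = cong (if_then 1ℤ else 0ℤ) (≢⇒≡ᵇ-false (¬mul 0))

-- Multiplying by q^(e t) delays the coefficient sequence by e steps.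
delay : ℕ → (ℕ → ℤ) → ℕ → ℤ
delay zero    v j       = v j
delay (suc e) v zero    = 0ℤ
delay (suc e) v (suc j) = delay e v j

delay-< : ∀ e v j → j < e → delay e v j ≡ 0ℤ
delay-< (suc e) v zero    _         = refl
delay-< (suc e) v (suc j) (s≤s j<e) = delay-< e v j j<e

delay-+ : ∀ e v d → delay e v (e + d) ≡ v d
delay-+ zero    v d = refl
delay-+ (suc e) v d = delay-+ e v d

delay-1 : ∀ e j → e ≤ j → delay e (1ℤ ℤ.^_) j ≡ 1ℤ
delay-1 e j e≤j = begin
  delay e (1ℤ ℤ.^_) j             ≡⟨ cong (delay e (1ℤ ℤ.^_)) (ℕₚ.m+[n∸m]≡n e≤j) ⟨
  delay e (1ℤ ℤ.^_) (e + (j ∸ e)) ≡⟨ delay-+ e (1ℤ ℤ.^_) (j ∸ e) ⟩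
  1ℤ ℤ.^ (j ∸ e)                  ≡⟨ ℤₚ.^-zeroˡ (j ∸ e) ⟩
  1ℤ                              ∎
  where open ≡-Reasoning

mono-⊛-inPowersOf : ∀ t .{{_ : NonZero t}} e {f v} →
  InPowersOf t f v → InPowersOf t (mono (e * t) ⊛ f) (delay e v)
mono-⊛-inPowersOf t e {f} {v} p .at-multiple j with ℕₚ.<-≤-connex j e
... | inj₁ j<e = trans (mono-⊛-below (e * t) (j * t) f (ℕₚ.*-monoˡ-< t j<e)) (sym (delay-< e v j j<e))
... | inj₂ e≤j = begin
    (mono (e * t) ⊛ f) (j * t)               ≡⟨ cong (mono (e * t) ⊛ f) j*t≡e*t+[j∸e]*t ⟩
    (mono (e * t) ⊛ f) (e * t + (j ∸ e) * t) ≡⟨ mono-⊛-shift (e * t) ((j ∸ e) * t) f ⟩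
    f ((j ∸ e) * t)                          ≡⟨ at-multiple p (j ∸ e) ⟩
    v (j ∸ e)                                ≡⟨ delay-+ e v (j ∸ e) ⟨
    delay e v (e + (j ∸ e))                  ≡⟨ cong (delay e v) (ℕₚ.m+[n∸m]≡n e≤j) ⟩
    delay e v j                              ∎
  where
  open ≡-Reasoning
  j*t≡e*t+[j∸e]*t : j * t ≡ e * t + (j ∸ e) * t
  j*t≡e*t+[j∸e]*t = trans (cong (_* t) (sym (ℕₚ.m+[n∸m]≡n e≤j))) (ℕₚ.*-distribʳ-+ t e (j ∸ e))
mono-⊛-inPowersOf t e {f} p .off-multiple w ¬mul with ℕₚ.<-≤-connex w (e * t)
... | inj₁ w<e*t = mono-⊛-below (e * t) w f w<e*t
... | inj₂ e*t≤w = trans (cong (mono (e * t) ⊛ f) (sym (ℕₚ.m+[n∸m]≡n e*t≤w)))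
      (trans (mono-⊛-shift (e * t) (w ∸ e * t) f) (off-multiple p (w ∸ e * t) ¬mul′))
  where
  ¬mul′ : ∀ j → j * t ≢ w ∸ e * t
  ¬mul′ j j*t≡w∸e*t = ¬mul (e + j)
    (trans (ℕₚ.*-distribʳ-+ t e j) (trans (cong (λ x → e * t + x) j*t≡w∸e*t) (ℕₚ.m+[n∸m]≡n e*t≤w)))

onePlusMono-⊛-inPowersOf : ∀ t .{{_ : NonZero t}} {g v} → InPowersOf t g v →
  InPowersOf t ((one ⊕ mono t) ⊛ g) (λ j → v j ℤ.+ delay 1 v j)
onePlusMono-⊛-inPowersOf t {g} p =
  inPowersOf-resp (≗-sym (≗-trans (⊛-distribʳ-⊕ one (mono t) g) (λ n → cong₂ ℤ._+_ (⊛-identityˡ g n) (mono-t≗ n))))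
    (inPowersOf-⊕ p (mono-⊛-inPowersOf t 1 p))
  where
  mono-t≗ : (mono t ⊛ g) ≗ (mono (1 * t) ⊛ g)
  mono-t≗ = ⊛-congʳ g (λ n → cong (λ e → mono e n) (sym (ℕₚ.*-identityˡ t)))

overFactor-inPowersOf : ∀ t .{{_ : NonZero t}} →
  InPowersOf t (overFactor t) (λ j → 1ℤ ℤ.^ j ℤ.+ delay 1 (1ℤ ℤ.^_) j)
overFactor-inPowersOf t = onePlusMono-⊛-inPowersOf t (inPowers-inPowersOf t (1ℤ ℤ.^_))

onePlusMono-⊛-geom-neg : ∀ t .{{_ : NonZero t}} → ((one ⊕ mono t) ⊛ geom -1ℤ t) ≗ one
onePlusMono-⊛-geom-neg t = inPowersOf-unique t
  (onePlusMono-⊛-inPowersOf t (inPowers-inPowersOf t (-1ℤ ℤ.^_))) (one-inPowersOf t) telescopes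
  where
  telescopes : ∀ j → -1ℤ ℤ.^ j ℤ.+ delay 1 (-1ℤ ℤ.^_) j ≡ 0ℤ ℤ.^ j
  telescopes zero    = refl
  telescopes (suc j) = trans (cong (ℤ._+ (-1ℤ ℤ.^ j)) (ℤₚ.-1*i≡-i (-1ℤ ℤ.^ j))) (ℤₚ.+-inverseˡ (-1ℤ ℤ.^ j))

overFactor-⊛-geom-neg : ∀ t .{{_ : NonZero t}} → (overFactor t ⊛ geom -1ℤ t) ≗ geom 1ℤ t
overFactor-⊛-geom-neg t = begin
  ((one ⊕ mono t) ⊛ G) ⊛ H   ≈⟨ ⊛-assoc (one ⊕ mono t) G H ⟩
  (one ⊕ mono t) ⊛ (G ⊛ H)   ≈⟨ ⊛-congˡ (one ⊕ mono t) (⊛-comm G H) ⟩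
  (one ⊕ mono t) ⊛ (H ⊛ G)   ≈⟨ ⊛-assoc (one ⊕ mono t) H G ⟨
  ((one ⊕ mono t) ⊛ H) ⊛ G   ≈⟨ ⊛-congʳ G (onePlusMono-⊛-geom-neg t) ⟩
  one ⊛ G                    ≈⟨ ⊛-identityˡ G ⟩
  G                          ∎
  where
  open ≗-Reasoning
  G = geom 1ℤ t
  H = geom -1ℤ t

prodBelow-cong : ∀ N {f g : ℕ → PS} → (∀ j → j < N → f j ≗ g j) → prodBelow N f ≗ prodBelow N g
prodBelow-cong zero    f≗g = ≗-refl
prodBelow-cong (suc N) f≗g =
  ⊛-cong (prodBelow-cong N (λ j j<N → f≗g j (ℕₚ.m<n⇒m<1+n j<N))) (f≗g N ℕₚ.≤-refl)

prodBelow-⊛ : ∀ N (f g : ℕ → PS) → prodBelow N (λ j → f j ⊛ g j) ≗ (prodBelow N f ⊛ prodBelow N g)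
prodBelow-⊛ zero    f g = ≗-sym (⊛-identityʳ one)
prodBelow-⊛ (suc N) f g = ≗-trans (⊛-congʳ (f N ⊛ g N) (prodBelow-⊛ N f g))
  (⊛-interchange (prodBelow N f) (prodBelow N g) (f N) (g N))

prodBelow-one : ∀ M d (f : ℕ → PS) → (∀ j → M ≤ j → f j ≗ one) → prodBelow (M + d) f ≗ prodBelow M f
prodBelow-one M zero    f f≗one = λ n → cong (λ N → prodBelow N f n) (ℕₚ.+-identityʳ M)
prodBelow-one M (suc d) f f≗one = begin
  prodBelow (M + suc d) f              ≡⟨ cong (λ N → prodBelow N f) (ℕₚ.+-suc M d) ⟩
  prodBelow (M + d) f ⊛ f (M + d)      ≈⟨ ⊛-cong (prodBelow-one M d f f≗one) (f≗one (M + d) (ℕₚ.m≤m+n M d)) ⟩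
  prodBelow M f ⊛ one                  ≈⟨ ⊛-identityʳ (prodBelow M f) ⟩
  prodBelow M f                        ∎
  where open ≗-Reasoning

prodBelow-suc-low : ∀ N (f : ℕ → PS) → f N 0 ≡ 1ℤ → (∀ e → 1 ≤ e → e ≤ N → f N e ≡ 0ℤ) →
  ∀ d → d ≤ N → prodBelow (suc N) f d ≡ prodBelow N f d
prodBelow-suc-low N f fN0≡1 fN≡0 d d≤N = begin
    sumBelow d (λ i → P i ℤ.* f N (d ∸ i)) ℤ.+ P d ℤ.* f N (d ∸ d)
  ≡⟨ cong₂ ℤ._+_ lower-terms (cong (λ e → P d ℤ.* f N e) (ℕₚ.n∸n≡0 d)) ⟩
    0ℤ ℤ.+ P d ℤ.* f N 0
  ≡⟨ trans (ℤₚ.+-identityˡ _) (cong (P d ℤ.*_) fN0≡1) ⟩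
    P d ℤ.* 1ℤ
  ≡⟨ ℤₚ.*-identityʳ (P d) ⟩
    P d
  ∎
  where
  open ≡-Reasoning
  P = prodBelow N f
  lower-terms : sumBelow d (λ i → P i ℤ.* f N (d ∸ i)) ≡ 0ℤ
  lower-terms = trans (sumBelow-cong d (λ i i<d → trans
      (cong (P i ℤ.*_) (fN≡0 (d ∸ i) (ℕₚ.m<n⇒0<n∸m i<d) (ℕₚ.≤-trans (ℕₚ.m∸n≤m d i) d≤N)))
      (ℤₚ.*-zeroʳ (P i))))
    (sumBelow-zero d)

prodBelow-truncate : ∀ (f : ℕ → PS) → (∀ N → f N 0 ≡ 1ℤ) → (∀ N e → 1 ≤ e → e ≤ N → f N e ≡ 0ℤ) →
  ∀ N d → d ≤ N → prodBelow N f d ≡ prodBelow d f d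
prodBelow-truncate f f0≡1 f≡0 N d d≤N with ℕₚ.m≤n⇒m<n∨m≡n d≤N
... | inj₂ refl = refl
prodBelow-truncate f f0≡1 f≡0 (suc N) d _ | inj₁ (s≤s d≤N) =
  trans (prodBelow-suc-low N f (f0≡1 N) (f≡0 N) d d≤N) (prodBelow-truncate f f0≡1 f≡0 N d d≤N)

overFactor-low : ∀ N e → 1 ≤ e → e ≤ N → overFactor (suc N) e ≡ 0ℤ
overFactor-low N e 1≤e e≤N = off-multiple (overFactor-inPowersOf (suc N)) e ¬mul
  where
  ¬mul : ∀ j → j * suc N ≢ e
  ¬mul zero    0≡e  = ℕₚ.<-irrefl 0≡e 1≤e
  ¬mul (suc j) e′≡e = ℕₚ.<-irrefl refl
    (ℕₚ.≤-trans (s≤s (ℕₚ.≤-trans e≤N (ℕₚ.m≤m+n N (j * suc N)))) (ℕₚ.≤-reflexive e′≡e))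

overGF-coeff : ∀ N d → d ≤ N → prodBelow N (λ j → overFactor (suc j)) d ≡ overGF d
overGF-coeff = prodBelow-truncate (λ j → overFactor (suc j))
  (λ N → at-multiple (overFactor-inPowersOf (suc N)) 0) overFactor-low

module _ {X : Set} where

  concatBelow : ℕ → (ℕ → List X) → List X
  concatBelow zero    F = []
  concatBelow (suc n) F = concatBelow n F ++ F n

  ∈-concatBelow⁻ : ∀ n F {x} → x ∈ concatBelow n F → ∃ λ i → i < n × x ∈ F i
  ∈-concatBelow⁻ (suc n) F x∈ with ∈-++⁻ (concatBelow n F) x∈
  ... | inj₁ x∈ˡ = let i , i<n , x∈Fi = ∈-concatBelow⁻ n F x∈ˡ in i , ℕₚ.m<n⇒m<1+n i<n , x∈Fi
  ... | inj₂ x∈Fn = n , ℕₚ.≤-refl , x∈Fn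

  ∈-concatBelow⁺ : ∀ n F {x i} → i < n → x ∈ F i → x ∈ concatBelow n F
  ∈-concatBelow⁺ (suc n) F {i = i} i<1+n x∈Fi with ℕₚ.m≤n⇒m<n∨m≡n (ℕₚ.≤-pred i<1+n)
  ... | inj₁ i<n  = ∈-++⁺ˡ (∈-concatBelow⁺ n F i<n x∈Fi)
  ... | inj₂ refl = ∈-++⁺ʳ (concatBelow n F) x∈Fi

  length-concatBelow : ∀ n F → + length (concatBelow n F) ≡ sumBelow n (λ i → + length (F i))
  length-concatBelow zero    F = refl
  length-concatBelow (suc n) F = begin
    + length (concatBelow n F ++ F n)                ≡⟨ cong +_ (Listₚ.length-++ (concatBelow n F)) ⟩
    + (length (concatBelow n F) + length (F n))      ≡⟨ ℤₚ.pos-+ (length (concatBelow n F)) (length (F n)) ⟩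
    + length (concatBelow n F) ℤ.+ + length (F n)    ≡⟨ cong (ℤ._+ + length (F n)) (length-concatBelow n F) ⟩
    sumBelow (suc n) (λ i → + length (F i))          ∎
    where open ≡-Reasoning

  concatBelow-unique : ∀ n F → (∀ i → Unique (F i)) →
    (∀ {i j x} → x ∈ F i → x ∈ F j → i ≡ j) → Unique (concatBelow n F)
  concatBelow-unique zero    F uniq disj = []
  concatBelow-unique (suc n) F uniq disj =
    Uniqueₚ.++⁺ (concatBelow-unique n F uniq disj) (uniq n) λ (x∈ˡ , x∈Fn) →
      let i , i<n , x∈Fi = ∈-concatBelow⁻ n F x∈ˡ in ℕₚ.<-irrefl (disj x∈Fi x∈Fn) i<n

module _ {B X : Set} where

  ∈-concatMap⁻′ : ∀ (G : B → List X) bs {x} → x ∈ concatMap G bs → ∃ λ b → b ∈ bs × x ∈ G b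
  ∈-concatMap⁻′ G bs x∈ = find (∈-concatMap⁻ G x∈)

  ∈-concatMap⁺′ : ∀ (G : B → List X) {bs x b} → b ∈ bs → x ∈ G b → x ∈ concatMap G bs
  ∈-concatMap⁺′ G b∈ x∈ = ∈-concatMap⁺ G (lose b∈ x∈)

  length-concatMap-const : ∀ (G : B → List X) bs L → (∀ b → length (G b) ≡ L) →
    length (concatMap G bs) ≡ length bs * L
  length-concatMap-const G []       L |G|≡L = refl
  length-concatMap-const G (b ∷ bs) L |G|≡L =
    trans (Listₚ.length-++ (G b)) (cong₂ _+_ (|G|≡L b) (length-concatMap-const G bs L |G|≡L))

  concatMap-unique : ∀ (G : B → List X) bs → Unique bs → (∀ b → Unique (G b)) →
    (∀ {b b′ x} → b ∈ bs → b′ ∈ bs → x ∈ G b → x ∈ G b′ → b ≡ b′) → Unique (concatMap G bs)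
  concatMap-unique G []       _            uniq disj = []
  concatMap-unique G (b ∷ bs) (b∉bs ∷ ubs) uniq disj =
    Uniqueₚ.++⁺ (uniq b) (concatMap-unique G bs ubs uniq (λ p q → disj (there p) (there q)))
      λ (x∈Gb , x∈rest) → let b′ , b′∈bs , x∈Gb′ = ∈-concatMap⁻′ G bs x∈rest in
        All.lookup b∉bs b′∈bs (disj (here refl) (there b′∈bs) x∈Gb x∈Gb′)

block : ℕ → ℕ → Bool → List Part
block t zero    o = []
block t (suc c) o = (t , o) ∷ replicate c (t , false)

ValidBlock : ℕ → Bool → Set
ValidBlock c o = c ≡ 0 → o ≡ false

PartsBelow : ℕ → List Part → Set
PartsBelow t = All (λ p → proj₁ p < t)

replicate-++-injective : ∀ t c c′ {π π′} → PartsBelow t π → PartsBelow t π′ →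
  replicate c (t , false) ++ π ≡ replicate c′ (t , false) ++ π′ → c ≡ c′ × π ≡ π′
replicate-++-injective t zero    zero     _        _          eq = refl , eq
replicate-++-injective t zero    (suc c′) (p<t ∷ _) _         refl = ⊥-elim (ℕₚ.<-irrefl refl p<t)
replicate-++-injective t (suc c) zero     _        (p<t ∷ _)  refl = ⊥-elim (ℕₚ.<-irrefl refl p<t)
replicate-++-injective t (suc c) (suc c′) π<t      π′<t       eq =
  let c≡c′ , π≡π′ = replicate-++-injective t c c′ π<t π′<t (Listₚ.∷-injectiveʳ eq) in cong suc c≡c′ , π≡π′

block-++-injective : ∀ t c o c′ o′ {π π′} → ValidBlock c o → ValidBlock c′ o′ →
  PartsBelow t π → PartsBelow t π′ → block t c o ++ π ≡ block t c′ o′ ++ π′ →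
  (c ≡ c′ × o ≡ o′) × π ≡ π′
block-++-injective t zero    o zero     o′ v v′ _         _         eq   = (refl , trans (v refl) (sym (v′ refl))) , eq
block-++-injective t zero    o (suc c′) o′ v v′ (p<t ∷ _) _         refl = ⊥-elim (ℕₚ.<-irrefl refl p<t)
block-++-injective t (suc c) o zero     o′ v v′ _         (p<t ∷ _) refl = ⊥-elim (ℕₚ.<-irrefl refl p<t)
block-++-injective t (suc c) o (suc c′) o′ v v′ π<t       π′<t      eq
  with refl ← Listₚ.∷-injectiveˡ eq =
  let c≡c′ , π≡π′ = replicate-++-injective t c c′ π<t π′<t (Listₚ.∷-injectiveʳ eq) in
  (cong suc c≡c′ , refl) , π≡π′

Step⇒≥ : ∀ {p p′} → Step p p′ → proj₁ p′ ≤ proj₁ p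
Step⇒≥ (inj₁ p′<p)       = ℕₚ.<⇒≤ p′<p
Step⇒≥ (inj₂ (p′≡p , _)) = ℕₚ.≤-reflexive p′≡p

parts-≤-head : ∀ {p π} → Linked Step (p ∷ π) → All (λ p′ → proj₁ p′ ≤ proj₁ p) π
parts-≤-head [-]       = []
parts-≤-head {p} {p′ ∷ _} (s ∷ lnk) =
  p′≤p ∷ All.map (λ q≤p′ → ℕₚ.≤-trans q≤p′ p′≤p) (parts-≤-head lnk)
  where p′≤p = Step⇒≥ {p} {p′} s

Linked-++⁻ʳ : ∀ xs {ys} → Linked Step (xs ++ ys) → Linked Step ys
Linked-++⁻ʳ []       lnk = lnk
Linked-++⁻ʳ (x ∷ xs) lnk = Linked-++⁻ʳ xs (Linked.tail lnk)

∷-linked : ∀ {p π} → Linked Step π → PartsBelow (proj₁ p) π → Linked Step (p ∷ π)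
∷-linked {π = []}    _   _          = [-]
∷-linked {π = _ ∷ _} lnk (p′<p ∷ _) = inj₁ p′<p ∷ lnk

block-++-linked : ∀ t c o π → Linked Step π → PartsBelow t π → Linked Step (block t c o ++ π)
block-++-linked t zero    o π lnk π<t = lnk
block-++-linked t (suc c) o π lnk π<t = head-linked o c
  where
  head-linked : ∀ o c → Linked Step ((t , o) ∷ replicate c (t , false) ++ π)
  head-linked o zero    = ∷-linked lnk π<t
  head-linked o (suc c) = inj₂ (refl , refl) ∷ head-linked false c

All-block : ∀ {P : Part → Set} t c o → (∀ o′ → P (t , o′)) → All P (block t c o)
All-block t zero    o Pt = []
All-block t (suc c) o Pt = Pt o ∷ Allₚ.replicate⁺ c (Pt false)

split-top-block : ∀ t π → Linked Step π → All (λ p → proj₁ p ≤ t) π →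
  ∃ λ c → ∃ λ o → ∃ λ π′ → ValidBlock c o × PartsBelow t π′ × π ≡ block t c o ++ π′
split-top-block t []             lnk π≤t = 0 , false , [] , (λ _ → refl) , [] , refl
split-top-block t ((s , o) ∷ π) lnk (s≤t ∷ _) with ℕₚ.m≤n⇒m<n∨m≡n s≤t
... | inj₁ s<t  = 0 , false , (s , o) ∷ π , (λ _ → refl) ,
                  s<t ∷ All.map (λ q≤s → ℕₚ.≤-<-trans q≤s s<t) (parts-≤-head lnk) , refl
... | inj₂ refl = let c , π′ , π′<s , π≡ = copies o π lnk in suc c , o , π′ , (λ ()) , π′<s , cong ((s , o) ∷_) π≡
  where
  copies : ∀ o π → Linked Step ((s , o) ∷ π) →
    ∃ λ c → ∃ λ π′ → PartsBelow s π′ × π ≡ replicate c (s , false) ++ π′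
  copies o []              _                        = 0 , [] , [] , refl
  copies o ((s′ , o′) ∷ π) (inj₁ s′<s ∷ lnk)        =
    0 , (s′ , o′) ∷ π , s′<s ∷ All.map (λ q≤s′ → ℕₚ.≤-<-trans q≤s′ s′<s) (parts-≤-head lnk) , refl
  copies o ((s′ , o′) ∷ π) (inj₂ (refl , refl) ∷ lnk) =
    let c , π′ , π′<s , π≡ = copies false π lnk in suc c , π′ , π′<s , cong ((s , false) ∷_) π≡

count-++ : ∀ xs ys t → count (xs ++ ys) t ≡ count xs t + count ys t
count-++ xs ys t = trans (cong length (Listₚ.filter-++ (λ p → proj₁ p ≟ t) xs ys))
  (Listₚ.length-++ (filter (λ p → proj₁ p ≟ t) xs))

count-∷-≡ : ∀ t o xs → count ((t , o) ∷ xs) t ≡ suc (count xs t)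
count-∷-≡ t o xs = cong length (Listₚ.filter-accept (λ p → proj₁ p ≟ t) {x = t , o} {xs = xs} refl)

count-∷-≢ : ∀ {s t} o xs → s ≢ t → count ((s , o) ∷ xs) t ≡ count xs t
count-∷-≢ {s} {t} o xs s≢t = cong length (Listₚ.filter-reject (λ p → proj₁ p ≟ t) {x = s , o} {xs = xs} s≢t)

count-block-≡ : ∀ t c o → count (block t c o) t ≡ c
count-block-≡ t zero    o = refl
count-block-≡ t (suc c) o = trans (count-∷-≡ t o _) (cong suc (count-replicate c))
  where
  count-replicate : ∀ c → count (replicate c (t , false)) t ≡ c
  count-replicate zero    = refl
  count-replicate (suc c) = trans (count-∷-≡ t false _) (cong suc (count-replicate c))

count-block-≢ : ∀ {s t} c o → s ≢ t → count (block s c o) t ≡ 0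
count-block-≢ {s} {t} zero    o s≢t = refl
count-block-≢ {s} {t} (suc c) o s≢t = trans (count-∷-≢ o _ s≢t) (count-replicate c)
  where
  count-replicate : ∀ c → count (replicate c (s , false)) t ≡ 0
  count-replicate zero    = refl
  count-replicate (suc c) = trans (count-∷-≢ false _ s≢t) (count-replicate c)

count-below : ∀ {t π} → PartsBelow t π → count π t ≡ 0
count-below {π = []}          []          = refl
count-below {π = (s , o) ∷ π} (s<t ∷ π<t) =
  trans (count-∷-≢ o π (λ s≡t → ℕₚ.<-irrefl s≡t s<t)) (count-below π<t)

∈-block⁻ : ∀ {t c o p} → p ∈ block t c o → proj₁ p ≡ t × (proj₂ p ≡ true → o ≡ true)
∈-block⁻ {c = suc c} (here refl) = refl , λ o≡true → o≡true
∈-block⁻ {c = suc c} (there p∈)  = ∈-replicate p∈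
  where
  ∈-replicate : ∀ {t c o p} → p ∈ replicate c (t , false) → proj₁ p ≡ t × (proj₂ p ≡ true → o ≡ true)
  ∈-replicate {c = suc c} (here refl) = refl , λ ()
  ∈-replicate {c = suc c} (there p∈)  = ∈-replicate {c = c} p∈

overlined-∈-block : ∀ t {c} → ValidBlock c true → (t , true) ∈ block t c true
overlined-∈-block t {zero}  v with () ← v refl
overlined-∈-block t {suc c} v = here refl

∉-below : ∀ {t π b} → PartsBelow t π → ¬ ((t , b) ∈ π)
∉-below (t<t ∷ _)   (here refl) = ℕₚ.<-irrefl refl t<t
∉-below (_ ∷ π<t) (there p∈)  = ∉-below π<t p∈

weight-++ : ∀ xs ys → weight (xs ++ ys) ≡ weight xs + weight ys
weight-++ xs ys = trans (cong sum (Listₚ.map-++ proj₁ xs ys)) (sum-++ (map proj₁ xs) (map proj₁ ys))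

weight-block : ∀ t c o → weight (block t c o) ≡ c * t
weight-block t zero    o = refl
weight-block t (suc c) o = cong (_+_ t) (weight-replicate c)
  where
  weight-replicate : ∀ c → weight (replicate c (t , false)) ≡ c * t
  weight-replicate zero    = refl
  weight-replicate (suc c) = cong (_+_ t) (weight-replicate c)

parts-≤-weight : ∀ π → All (λ p → proj₁ p ≤ weight π) π
parts-≤-weight []       = []
parts-≤-weight (p ∷ π) = ℕₚ.m≤m+n (proj₁ p) (weight π)
  ∷ All.map (λ q≤w → ℕₚ.≤-trans q≤w (ℕₚ.m≤n+m (weight π) (proj₁ p))) (parts-≤-weight π)

count-block-++-≡ : ∀ t c o {π} → PartsBelow t π → count (block t c o ++ π) t ≡ c
count-block-++-≡ t c o {π} π<t = begin
  count (block t c o ++ π) t          ≡⟨ count-++ (block t c o) π t ⟩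
  count (block t c o) t + count π t   ≡⟨ cong₂ _+_ (count-block-≡ t c o) (count-below π<t) ⟩
  c + 0                               ≡⟨ ℕₚ.+-identityʳ c ⟩
  c                                   ∎
  where open ≡-Reasoning

count-block-++-≢ : ∀ {t s} c o π → t ≢ s → count (block t c o ++ π) s ≡ count π s
count-block-++-≢ {t} {s} c o π t≢s =
  trans (count-++ (block t c o) π s) (cong (_+ count π s) (count-block-≢ c o t≢s))

data Quota : Set where
  free full short : Quota

validBlocks : ℕ → List (ℕ × Bool)
validBlocks zero    = (0 , false) ∷ []
validBlocks (suc c) = (suc c , false) ∷ (suc c , true) ∷ []

∈-validBlocks⁻ : ∀ {c c′ o} → (c′ , o) ∈ validBlocks c → c′ ≡ c × ValidBlock c′ o
∈-validBlocks⁻ {zero}  (here refl)         = refl , λ _ → refl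
∈-validBlocks⁻ {suc c} (here refl)         = refl , λ ()
∈-validBlocks⁻ {suc c} (there (here refl)) = refl , λ ()

∈-validBlocks⁺ : ∀ {c o} → ValidBlock c o → (c , o) ∈ validBlocks c
∈-validBlocks⁺ {zero}          v with refl ← v refl = here refl
∈-validBlocks⁺ {suc c} {false} v = here refl
∈-validBlocks⁺ {suc c} {true}  v = there (here refl)

validBlocks-unique : ∀ c → Unique (validBlocks c)
validBlocks-unique zero    = [] ∷ []
validBlocks-unique (suc c) = ((λ ()) ∷ []) ∷ [] ∷ []

module _ (r : ℕ) where

  Meets : Quota → ℕ → List Part → Set
  Meets free  t π = ⊤
  Meets full  t π = r ≤ count π t × ¬ ((t , true) ∈ π)
  Meets short t π = count π t < r

  BlockMeets : Quota → ℕ → Bool → Set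
  BlockMeets free  c o = ⊤
  BlockMeets full  c o = r ≤ c × o ≡ false
  BlockMeets short c o = c < r

  blocks : Quota → ℕ → List (ℕ × Bool)
  blocks free  c = validBlocks c
  blocks full  c with r ≤? c
  ... | yes _ = (c , false) ∷ []
  ... | no  _ = []
  blocks short c with c <? r
  ... | yes _ = validBlocks c
  ... | no  _ = []

  ∈-blocks⁻ : ∀ q {c c′ o} → (c′ , o) ∈ blocks q c → c′ ≡ c × ValidBlock c′ o × BlockMeets q c′ o
  ∈-blocks⁻ free  b∈ = let c′≡c , v = ∈-validBlocks⁻ b∈ in c′≡c , v , tt
  ∈-blocks⁻ full  {c} b∈ with r ≤? c
  ∈-blocks⁻ full  (here refl) | yes r≤c = refl , (λ _ → refl) , r≤c , refl
  ∈-blocks⁻ short {c} b∈ with c <? r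
  ... | yes c<r = let c′≡c , v = ∈-validBlocks⁻ b∈ in c′≡c , v , subst (_< r) (sym c′≡c) c<r

  ∈-blocks⁺ : ∀ q {c o} → ValidBlock c o → BlockMeets q c o → (c , o) ∈ blocks q c
  ∈-blocks⁺ free  v _ = ∈-validBlocks⁺ v
  ∈-blocks⁺ full  {c} v (r≤c , refl) with r ≤? c
  ... | yes _   = here refl
  ... | no  r≰c = ⊥-elim (r≰c r≤c)
  ∈-blocks⁺ short {c} v c<r with c <? r
  ... | yes _   = ∈-validBlocks⁺ v
  ... | no  c≮r = ⊥-elim (c≮r c<r)

  blocks-unique : ∀ q c → Unique (blocks q c)
  blocks-unique free  c = validBlocks-unique c
  blocks-unique full  c with r ≤? c
  ... | yes _ = [] ∷ []
  ... | no  _ = []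
  blocks-unique short c with c <? r
  ... | yes _ = validBlocks-unique c
  ... | no  _ = []

  meets-top⇒ : ∀ q t c o {π} → ValidBlock c o → PartsBelow t π →
    Meets q t (block t c o ++ π) → BlockMeets q c o
  meets-top⇒ free  t c o v π<t _ = tt
  meets-top⇒ full  t c o {π} v π<t (r≤count , ¬overlined) =
    subst (r ≤_) (count-block-++-≡ t c o π<t) r≤count , not-overlined o (λ o≡true → ¬overlined (∈-++⁺ˡ (overlined o≡true)))
    where
    overlined : o ≡ true → (t , true) ∈ block t c o
    overlined refl = overlined-∈-block t v
    not-overlined : ∀ o → ¬ (o ≡ true) → o ≡ false
    not-overlined false _ = refl
    not-overlined true  h = ⊥-elim (h refl)
  meets-top⇒ short t c o v π<t count<r = subst (_< r) (count-block-++-≡ t c o π<t) count<r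

  meets-top⇐ : ∀ q t c o {π} → ValidBlock c o → PartsBelow t π →
    BlockMeets q c o → Meets q t (block t c o ++ π)
  meets-top⇐ free  t c o v π<t _ = tt
  meets-top⇐ full  t c o v π<t (r≤c , refl) =
    subst (r ≤_) (sym (count-block-++-≡ t c o π<t)) r≤c , not-overlined
    where
    not-overlined : ¬ ((t , true) ∈ block t c false ++ _)
    not-overlined t∈ with ∈-++⁻ (block t c false) t∈
    ... | inj₁ t∈block = case (proj₂ (∈-block⁻ t∈block) refl) of λ ()
    ... | inj₂ t∈π     = ∉-below π<t t∈π
  meets-top⇐ short t c o v π<t c<r = subst (_< r) (sym (count-block-++-≡ t c o π<t)) c<r

  meets-other⇒ : ∀ q {s t} c o π → t ≢ s → Meets q s (block t c o ++ π) → Meets q s π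
  meets-other⇒ free  c o π t≢s _ = tt
  meets-other⇒ full  c o π t≢s (r≤count , ¬overlined) =
    subst (r ≤_) (count-block-++-≢ c o π t≢s) r≤count , λ s∈π → ¬overlined (∈-++⁺ʳ _ s∈π)
  meets-other⇒ short c o π t≢s count<r = subst (_< r) (count-block-++-≢ c o π t≢s) count<r

  meets-other⇐ : ∀ q {s t} c o π → t ≢ s → Meets q s π → Meets q s (block t c o ++ π)
  meets-other⇐ free  c o π t≢s _ = tt
  meets-other⇐ full  {s} {t} c o π t≢s (r≤count , ¬overlined) =
    subst (r ≤_) (sym (count-block-++-≢ c o π t≢s)) r≤count , not-overlined
    where
    not-overlined : ¬ ((s , true) ∈ block t c o ++ π)
    not-overlined s∈ with ∈-++⁻ (block t c o) s∈
    ... | inj₁ s∈block = t≢s (sym (proj₁ (∈-block⁻ s∈block)))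
    ... | inj₂ s∈π     = ¬overlined s∈π
  meets-other⇐ short c o π t≢s count<r = subst (_< r) (sym (count-block-++-≢ c o π t≢s)) count<r

  module _ (quota : ℕ → Quota) where

    blocksOfWeight : ℕ → ℕ → List (ℕ × Bool)
    blocksOfWeight t w = concatBelow (suc w) (λ c → if c * t ≡ᵇ w then blocks (quota t) c else [])

    ∈-blocksOfWeight⁻ : ∀ t w {c o} → (c , o) ∈ blocksOfWeight t w →
      ValidBlock c o × c * t ≡ w × BlockMeets (quota t) c o
    ∈-blocksOfWeight⁻ t w b∈ with ∈-concatBelow⁻ (suc w) _ b∈
    ... | c′ , _ , b∈′ with c′ * t ≡ᵇ w in c′t≡w
    ... | true with refl , v , meets ← ∈-blocks⁻ (quota t) b∈′ = v , ≡ᵇ-true⇒≡ c′t≡w , meets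

    ∈-blocksOfWeight⁺ : ∀ t w {c o} → 1 ≤ t → ValidBlock c o → c * t ≡ w → BlockMeets (quota t) c o →
      (c , o) ∈ blocksOfWeight t w
    ∈-blocksOfWeight⁺ t w {c} {o} 1≤t v c*t≡w meets =
      ∈-concatBelow⁺ (suc w) (λ c → if c * t ≡ᵇ w then blocks (quota t) c else []) (s≤s c≤w) b∈
      where
      c≤w : c ≤ w
      c≤w = subst (c ≤_) c*t≡w (subst (_≤ c * t) (ℕₚ.*-identityʳ c) (ℕₚ.*-monoʳ-≤ c 1≤t))
      b∈ : (c , o) ∈ (if c * t ≡ᵇ w then blocks (quota t) c else [])
      b∈ rewrite ≡⇒≡ᵇ-true c*t≡w = ∈-blocks⁺ (quota t) v meets

    blocksOfWeight-unique : ∀ t w → Unique (blocksOfWeight t w)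
    blocksOfWeight-unique t w = concatBelow-unique (suc w) _ unique disjoint
      where
      unique : ∀ c → Unique (if c * t ≡ᵇ w then blocks (quota t) c else [])
      unique c with c * t ≡ᵇ w
      ... | true  = blocks-unique (quota t) c
      ... | false = []
      multiplicity : ∀ {c c′ o} → (c′ , o) ∈ (if c * t ≡ᵇ w then blocks (quota t) c else []) → c′ ≡ c
      multiplicity {c} b∈ with c * t ≡ᵇ w
      ... | true = proj₁ (∈-blocks⁻ (quota t) b∈)
      disjoint : ∀ {c c′ b} → b ∈ (if c * t ≡ᵇ w then blocks (quota t) c else []) →
        b ∈ (if c′ * t ≡ᵇ w then blocks (quota t) c′ else []) → c ≡ c′
      disjoint {b = _ , _} b∈ b∈′ = trans (sym (multiplicity b∈)) (multiplicity b∈′)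

    withTopBlock : ℕ → ℕ → List (List Part) → List (List Part)
    withTopBlock t w πs = concatMap (λ (c , o) → map (block t c o ++_) πs) (blocksOfWeight t w)

    ∈-withTopBlock⁻ : ∀ t w πs {π} → π ∈ withTopBlock t w πs →
      ∃ λ c → ∃ λ o → ∃ λ π′ → (c , o) ∈ blocksOfWeight t w × π′ ∈ πs × π ≡ block t c o ++ π′
    ∈-withTopBlock⁻ t w πs π∈ with ∈-concatMap⁻′ _ (blocksOfWeight t w) π∈
    ... | (c , o) , b∈ , π∈′ with ∈-map⁻ (block t c o ++_) π∈′
    ... | π′ , π′∈ , π≡ = c , o , π′ , b∈ , π′∈ , π≡

    ∈-withTopBlock⁺ : ∀ t w πs {c o π′} → (c , o) ∈ blocksOfWeight t w → π′ ∈ πs →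
      block t c o ++ π′ ∈ withTopBlock t w πs
    ∈-withTopBlock⁺ t w πs {c} {o} b∈ π′∈ = ∈-concatMap⁺′ _ b∈ (∈-map⁺ (block t c o ++_) π′∈)

    length-withTopBlock : ∀ t w πs → length (withTopBlock t w πs) ≡ length (blocksOfWeight t w) * length πs
    length-withTopBlock t w πs =
      length-concatMap-const _ (blocksOfWeight t w) (length πs) (λ _ → Listₚ.length-map _ πs)

    withTopBlock-unique : ∀ t w πs → Unique πs → All (PartsBelow t) πs → Unique (withTopBlock t w πs)
    withTopBlock-unique t w πs uπs πs<t =
      concatMap-unique _ (blocksOfWeight t w) (blocksOfWeight-unique t w)
        (λ (c , o) → Uniqueₚ.map⁺ (Listₚ.++-cancelˡ (block t c o) _ _) uπs) same-block
      where
      same-block : ∀ {b b′ π} → b ∈ blocksOfWeight t w → b′ ∈ blocksOfWeight t w →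
        π ∈ map (block t (proj₁ b) (proj₂ b) ++_) πs → π ∈ map (block t (proj₁ b′) (proj₂ b′) ++_) πs → b ≡ b′
      same-block {c , o} {c′ , o′} b∈ b′∈ π∈ π∈′
        with π₁ , π₁∈ , refl ← ∈-map⁻ (block t c o ++_) π∈
           | π₂ , π₂∈ , π≡ ← ∈-map⁻ (block t c′ o′ ++_) π∈′
        with (refl , refl) , _ ← block-++-injective t c o c′ o′
               (proj₁ (∈-blocksOfWeight⁻ t w b∈)) (proj₁ (∈-blocksOfWeight⁻ t w b′∈))
               (All.lookup πs<t π₁∈) (All.lookup πs<t π₂∈) π≡
        = refl

    Admissible : ℕ → List Part → Set
    Admissible N π = IsOverpartition π × All (λ p → proj₁ p ≤ N) π ×
                     (∀ t → 1 ≤ t → t ≤ N → Meets (quota t) t π)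

    admissible : ℕ → ℕ → List (List Part)
    admissible zero    n = if n ≡ᵇ 0 then [] ∷ [] else []
    admissible (suc N) n = concatBelow (suc n) (λ i → withTopBlock (suc N) (n ∸ i) (admissible N i))

    admissible-block-++ : ∀ N c o π → ValidBlock c o → BlockMeets (quota (suc N)) c o →
      Admissible N π → Admissible (suc N) (block (suc N) c o ++ π)
    admissible-block-++ N c o π v meets ((π>0 , lnk) , π≤N , π-meets) =
      (Allₚ.++⁺ (All-block (suc N) c o (λ _ → s≤s z≤n)) π>0 , block-++-linked (suc N) c o π lnk π<t) ,
      Allₚ.++⁺ (All-block (suc N) c o (λ _ → ℕₚ.≤-refl)) (All.map ℕₚ.m≤n⇒m≤1+n π≤N) ,
      meets′
      where
      π<t : PartsBelow (suc N) π
      π<t = All.map s≤s π≤N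
      meets′ : ∀ s → 1 ≤ s → s ≤ suc N → Meets (quota s) s (block (suc N) c o ++ π)
      meets′ s 1≤s s≤1+N with ℕₚ.m≤n⇒m<n∨m≡n s≤1+N
      ... | inj₂ refl = meets-top⇐ (quota s) s c o v π<t meets
      ... | inj₁ s<1+N = meets-other⇐ (quota s) c o π (λ 1+N≡s → ℕₚ.<-irrefl (sym 1+N≡s) s<1+N)
                           (π-meets s 1≤s (ℕₚ.≤-pred s<1+N))

    admissible-block-++⁻ : ∀ N c o π → ValidBlock c o → PartsBelow (suc N) π →
      Admissible (suc N) (block (suc N) c o ++ π) → BlockMeets (quota (suc N)) c o × Admissible N π
    admissible-block-++⁻ N c o π v π<t ((parts>0 , lnk) , _ , meets) =
      meets-top⇒ (quota (suc N)) (suc N) c o v π<t (meets (suc N) (s≤s z≤n) ℕₚ.≤-refl) ,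
      (Allₚ.++⁻ʳ (block (suc N) c o) parts>0 , Linked-++⁻ʳ (block (suc N) c o) lnk) ,
      All.map ℕₚ.≤-pred π<t ,
      λ s 1≤s s≤N → meets-other⇒ (quota s) c o π (λ 1+N≡s → ℕₚ.<-irrefl (sym 1+N≡s) (s≤s s≤N))
                      (meets s 1≤s (ℕₚ.m≤n⇒m≤1+n s≤N))

    admissible-sound : ∀ N n {π} → π ∈ admissible N n → Admissible N π × weight π ≡ n
    admissible-sound zero    n π∈ with n ≡ᵇ 0 in n≡0 | π∈
    ... | true | here refl = ((([] , [])) , [] , λ t 1≤t t≤0 → ⊥-elim (ℕₚ.<-irrefl refl (ℕₚ.≤-trans 1≤t t≤0))) ,
                             sym (≡ᵇ-true⇒≡ n≡0)
    admissible-sound (suc N) n π∈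
      with i , i<1+n , π∈i ← ∈-concatBelow⁻ (suc n) _ π∈
      with c , o , π′ , b∈ , π′∈ , refl ← ∈-withTopBlock⁻ (suc N) (n ∸ i) (admissible N i) π∈i
      with v , c*t≡n∸i , meets ← ∈-blocksOfWeight⁻ (suc N) (n ∸ i) b∈
         | adm , weight≡i ← admissible-sound N i π′∈
      = admissible-block-++ N c o π′ v meets adm , (begin
          weight (block (suc N) c o ++ π′)           ≡⟨ weight-++ (block (suc N) c o) π′ ⟩
          weight (block (suc N) c o) + weight π′     ≡⟨ cong₂ _+_ (trans (weight-block (suc N) c o) c*t≡n∸i) weight≡i ⟩
          n ∸ i + i                                  ≡⟨ ℕₚ.m∸n+n≡m (ℕₚ.≤-pred i<1+n) ⟩
          n                                          ∎)
      where open ≡-Reasoning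

    admissible-complete : ∀ N n π → Admissible N π → weight π ≡ n → π ∈ admissible N n
    admissible-complete zero    n []      _                          refl = here refl
    admissible-complete zero    n (p ∷ π) ((p>0 ∷ _ , _) , p≤0 ∷ _ , _) _ = ⊥-elim (ℕₚ.<-irrefl refl (ℕₚ.≤-trans p>0 p≤0))
    admissible-complete (suc N) n π adm@((_ , lnk) , π≤t , _) weight≡n
      with c , o , π′ , v , π′<t , refl ← split-top-block (suc N) π lnk π≤t
      with meets , adm′ ← admissible-block-++⁻ N c o π′ v π′<t adm
      = ∈-concatBelow⁺ (suc n) _ (s≤s i≤n)
          (∈-withTopBlock⁺ (suc N) (n ∸ i) (admissible N i)
            (∈-blocksOfWeight⁺ (suc N) (n ∸ i) (s≤s z≤n) v c*t≡n∸i meets)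
            (admissible-complete N i π′ adm′ refl))
      where
      i = weight π′
      c*t+i≡n : c * suc N + i ≡ n
      c*t+i≡n = trans (cong (_+ i) (sym (weight-block (suc N) c o)))
                      (trans (sym (weight-++ (block (suc N) c o) π′)) weight≡n)
      i≤n : i ≤ n
      i≤n = subst (i ≤_) c*t+i≡n (ℕₚ.m≤n+m i (c * suc N))
      c*t≡n∸i : c * suc N ≡ n ∸ i
      c*t≡n∸i = trans (sym (ℕₚ.m+n∸n≡m (c * suc N) i)) (cong (_∸ i) c*t+i≡n)

    admissible-below : ∀ N n {π} → π ∈ admissible N n → PartsBelow (suc N) π
    admissible-below N n π∈ = All.map s≤s (proj₁ (proj₂ (proj₁ (admissible-sound N n π∈))))

    admissible-unique : ∀ N n → Unique (admissible N n)
    admissible-unique zero    n with n ≡ᵇ 0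
    ... | true  = [] ∷ []
    ... | false = []
    admissible-unique (suc N) n = concatBelow-unique (suc n) _
      (λ i → withTopBlock-unique (suc N) (n ∸ i) (admissible N i) (admissible-unique N i)
               (All.tabulate (admissible-below N i)))
      same-weight
      where
      same-weight : ∀ {i j π} → π ∈ withTopBlock (suc N) (n ∸ i) (admissible N i) →
        π ∈ withTopBlock (suc N) (n ∸ j) (admissible N j) → i ≡ j
      same-weight {i} {j} π∈ π∈′
        with c , o , π₁ , b∈ , π₁∈ , refl ← ∈-withTopBlock⁻ (suc N) (n ∸ i) (admissible N i) π∈
           | c′ , o′ , π₂ , b∈′ , π₂∈ , π≡ ← ∈-withTopBlock⁻ (suc N) (n ∸ j) (admissible N j) π∈′
        with _ , refl ← block-++-injective (suc N) c o c′ o′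
               (proj₁ (∈-blocksOfWeight⁻ (suc N) (n ∸ i) b∈)) (proj₁ (∈-blocksOfWeight⁻ (suc N) (n ∸ j) b∈′))
               (admissible-below N i π₁∈) (admissible-below N j π₂∈) π≡
        = trans (sym (proj₂ (admissible-sound N i π₁∈))) (proj₂ (admissible-sound N j π₂∈))

    blockCounts : ℕ → PS
    blockCounts t w = + length (blocksOfWeight t w)

    length-admissible : ∀ N n → + length (admissible N n) ≡ prodBelow N (λ j → blockCounts (suc j)) n
    length-admissible zero    zero    = refl
    length-admissible zero    (suc n) = refl
    length-admissible (suc N) n = trans (length-concatBelow (suc n) _) (sumBelow-cong (suc n) λ i _ → begin
        + length (withTopBlock (suc N) (n ∸ i) (admissible N i))
      ≡⟨ cong +_ (length-withTopBlock (suc N) (n ∸ i) (admissible N i)) ⟩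
        + (length (blocksOfWeight (suc N) (n ∸ i)) * length (admissible N i))
      ≡⟨ ℤₚ.pos-* (length (blocksOfWeight (suc N) (n ∸ i))) (length (admissible N i)) ⟩
        blockCounts (suc N) (n ∸ i) ℤ.* + length (admissible N i)
      ≡⟨ ℤₚ.*-comm (blockCounts (suc N) (n ∸ i)) _ ⟩
        + length (admissible N i) ℤ.* blockCounts (suc N) (n ∸ i)
      ≡⟨ cong (ℤ._* blockCounts (suc N) (n ∸ i)) (length-admissible N i) ⟩
        prodBelow N (λ j → blockCounts (suc j)) i ℤ.* blockCounts (suc N) (n ∸ i)
      ∎)
      where open ≡-Reasoning

-- Each size t contributes (1 + q^t)/(1 - q^t): c ≥ 1 copies come with or without an overline.
overFactor-counts-validBlocks : ∀ t .{{_ : NonZero t}} →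
  InPowersOf t (overFactor t) (λ c → + length (validBlocks c))
overFactor-counts-validBlocks t =
  record { at-multiple  = λ c → trans (at-multiple (overFactor-inPowersOf t) c) (coeff c)
         ; off-multiple = off-multiple (overFactor-inPowersOf t) }
  where
  coeff : ∀ c → 1ℤ ℤ.^ c ℤ.+ delay 1 (1ℤ ℤ.^_) c ≡ + length (validBlocks c)
  coeff zero    = refl
  coeff (suc c) = cong₂ ℤ._+_ (ℤₚ.^-zeroˡ (suc c)) (ℤₚ.^-zeroˡ c)

overFactor-⊛-mono-⊛-geom-neg : ∀ t .{{_ : NonZero t}} e →
  (overFactor t ⊛ (mono e ⊛ geom -1ℤ t)) ≗ (mono e ⊛ geom 1ℤ t)
overFactor-⊛-mono-⊛-geom-neg t e = begin
  O ⊛ (M ⊛ H)    ≈⟨ ⊛-congˡ O (⊛-comm M H) ⟩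
  O ⊛ (H ⊛ M)    ≈⟨ ⊛-assoc O H M ⟨
  (O ⊛ H) ⊛ M    ≈⟨ ⊛-congʳ M (overFactor-⊛-geom-neg t) ⟩
  geom 1ℤ t ⊛ M  ≈⟨ ⊛-comm (geom 1ℤ t) M ⟩
  M ⊛ geom 1ℤ t  ∎
  where
  open ≗-Reasoning
  O = overFactor t
  M = mono e
  H = geom -1ℤ t

length-if : ∀ {X : Set} b (xs : List X) → + length (if b then xs else []) ≡ (if b then + length xs else 0ℤ)
length-if true  xs = refl
length-if false xs = refl

module _ (r : ℕ) where

  tailFactor : ℕ → PS
  tailFactor t = mono (r * t) ⊛ geom -1ℤ t

  quotaFactor : Quota → ℕ → PS
  quotaFactor free  t = one
  quotaFactor full  t = tailFactor t
  quotaFactor short t = one ⊖ ((+ 2) · tailFactor t)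

  quotaCoeff : Quota → ℕ → ℤ
  quotaCoeff free  c = + length (validBlocks c)
  quotaCoeff full  c = delay r (1ℤ ℤ.^_) c
  quotaCoeff short c = + length (validBlocks c) ℤ.- + 2 ℤ.* delay r (1ℤ ℤ.^_) c

  overFactor-⊛-quotaFactor : ∀ q t .{{_ : NonZero t}} →
    InPowersOf t (overFactor t ⊛ quotaFactor q t) (quotaCoeff q)
  overFactor-⊛-quotaFactor free t =
    inPowersOf-resp (≗-sym (⊛-identityʳ (overFactor t))) (overFactor-counts-validBlocks t)
  overFactor-⊛-quotaFactor full t =
    inPowersOf-resp (≗-sym (overFactor-⊛-mono-⊛-geom-neg t (r * t)))
      (mono-⊛-inPowersOf t r (inPowers-inPowersOf t (1ℤ ℤ.^_)))
  overFactor-⊛-quotaFactor short t = inPowersOf-resp (≗-sym expand)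
    (inPowersOf-⊖ (overFactor-counts-validBlocks t)
      (inPowersOf-· (+ 2) (mono-⊛-inPowersOf t r (inPowers-inPowersOf t (1ℤ ℤ.^_)))))
    where
    open ≗-Reasoning
    O = overFactor t
    expand : (O ⊛ (one ⊖ ((+ 2) · tailFactor t))) ≗ (O ⊖ ((+ 2) · (mono (r * t) ⊛ geom 1ℤ t)))
    expand = begin
      O ⊛ (one ⊖ ((+ 2) · tailFactor t))               ≈⟨ ⊛-distribˡ-⊖ O one ((+ 2) · tailFactor t) ⟩
      (O ⊛ one) ⊖ (O ⊛ ((+ 2) · tailFactor t))          ≈⟨ ⊖-cong (⊛-identityʳ O) (⊛-·ʳ (+ 2) O (tailFactor t)) ⟩
      O ⊖ ((+ 2) · (O ⊛ tailFactor t))                  ≈⟨ ⊖-cong {f = O} ≗-refl (·-congˡ (+ 2) (overFactor-⊛-mono-⊛-geom-neg t (r * t))) ⟩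
      O ⊖ ((+ 2) · (mono (r * t) ⊛ geom 1ℤ t))          ∎

  length-blocks : 1 ≤ r → ∀ q c → + length (blocks r q c) ≡ quotaCoeff q c
  length-blocks 1≤r free  c = refl
  length-blocks 1≤r full  c with r ≤? c
  ... | yes r≤c = sym (delay-1 r c r≤c)
  ... | no  r≰c = sym (delay-< r (1ℤ ℤ.^_) c (ℕₚ.≰⇒> r≰c))
  length-blocks 1≤r short c with c <? r
  ... | yes c<r rewrite delay-< r (1ℤ ℤ.^_) c c<r = sym (ℤₚ.+-identityʳ _)
  length-blocks 1≤r short zero    | no 0≮r = ⊥-elim (0≮r 1≤r)
  length-blocks 1≤r short (suc c) | no c≮r rewrite delay-1 r (suc c) (ℕₚ.≮⇒≥ c≮r) = refl

  blockCounts≗ : 1 ≤ r → ∀ quota t .{{_ : NonZero t}} →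
    blockCounts r quota t ≗ (overFactor t ⊛ quotaFactor (quota t) t)
  blockCounts≗ 1≤r quota t = inPowersOf-unique t counts (overFactor-⊛-quotaFactor (quota t) t)
    (length-blocks 1≤r (quota t))
    where
    counts : InPowersOf t (blockCounts r quota t) (λ c → + length (blocks r (quota t) c))
    counts = inPowersOf-resp (λ w → sym (trans (length-concatBelow (suc w) _)
                                         (sumBelow-cong (suc w) (λ c _ → length-if (c * t ≡ᵇ w) _))))
                             (inPowers-inPowersOf t (λ c → + length (blocks r (quota t) c)))

∣+m-+n∣≡m∸n : ∀ {m n} → n ≤ m → ℤ.∣ + m ℤ.- + n ∣ ≡ m ∸ n
∣+m-+n∣≡m∸n {m} {n} n≤m = trans (cong ℤ.∣_∣ (ℤₚ.m-n≡m⊖n m n)) (trans (ℤₚ.∣m⊖n∣≡∣n⊖m∣ m n) (ℤₚ.∣⊖∣-≤ n≤m))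

∣+m-+n∣≡n∸m : ∀ {m n} → m < n → ℤ.∣ + m ℤ.- + n ∣ ≡ n ∸ m
∣+m-+n∣≡n∸m {m} {n} m<n = trans (cong ℤ.∣_∣ (ℤₚ.m-n≡m⊖n m n)) (ℤₚ.∣⊖∣-< m<n)

congMod-+ : ∀ A a i → CongMod A (i * A + a) a
congMod-+ A a i = divides i (trans (∣+m-+n∣≡m∸n (ℕₚ.m≤n+m a (i * A))) (ℕₚ.m+n∸n≡m (i * A) a))

congMod⇒+ : ∀ A a → 1 ≤ a → a ≤ A → ∀ x → 1 ≤ x → CongMod A x a → ∃ λ i → i * A + a ≡ x
congMod⇒+ A a 1≤a a≤A x 1≤x (divides q ∣x-a∣≡qA) with ℕₚ.<-≤-connex x a
... | inj₂ a≤x = q , trans (cong (_+ a) (trans (sym ∣x-a∣≡qA) (∣+m-+n∣≡m∸n a≤x))) (ℕₚ.m∸n+n≡m a≤x)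
... | inj₁ x<a = ⊥-elim (too-small q (trans (sym (∣+m-+n∣≡n∸m x<a)) ∣x-a∣≡qA))
  where
  too-small : ∀ q → a ∸ x ≢ q * A
  too-small zero    a∸x≡0  = ℕₚ.<-irrefl (sym a∸x≡0) (ℕₚ.m<n⇒0<n∸m x<a)
  too-small (suc q) a∸x≡qA = ℕₚ.<-irrefl refl (ℕₚ.<-≤-trans (ℕₚ.∸-monoʳ-< {a} {x} {0} 1≤x (ℕₚ.<⇒≤ x<a))
    (ℕₚ.≤-trans a≤A (subst (A ≤_) (sym a∸x≡qA) (ℕₚ.m≤m+n A (q * A)))))

module Rungs (A a r k : ℕ) (1≤a : 1 ≤ a) (a≤A : a ≤ A) (1≤r : 1 ≤ r) where

  instance
    A-nonZero : NonZero A
    A-nonZero = ℕ.>-nonZero (ℕₚ.≤-trans 1≤a a≤A)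

  rung : ℕ → ℕ
  rung i = i * A + a

  m : ℕ
  m = rung k

  rung-< : ∀ {i j} → i < j → rung i < rung j
  rung-< i<j = ℕₚ.+-monoˡ-< a (ℕₚ.*-monoˡ-< A i<j)

  rung-injective : ∀ {i j} → rung i ≡ rung j → i ≡ j
  rung-injective {i} {j} eq = ℕₚ.*-cancelʳ-≡ i j A (ℕₚ.+-cancelʳ-≡ a (i * A) (j * A) eq)

  a≤rung : ∀ i → a ≤ rung i
  a≤rung i = ℕₚ.m≤n+m a (i * A)

  quota : ℕ → Quota
  quota t with t ≟ m | ℕₚ.anyUpTo? (λ i → rung i ≟ t) k
  ... | yes _ | _     = short
  ... | no  _ | yes _ = full
  ... | no  _ | no  _ = free

  data QuotaView (t : ℕ) : Quota → Set where
    at-m       : t ≡ m → QuotaView t short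
    lower-rung : ∀ i → i < k → rung i ≡ t → QuotaView t full
    elsewhere  : t ≢ m → (∀ i → i < k → rung i ≢ t) → QuotaView t free

  quota-view : ∀ t → QuotaView t (quota t)
  quota-view t with t ≟ m | ℕₚ.anyUpTo? (λ i → rung i ≟ t) k
  ... | yes t≡m | _                  = at-m t≡m
  ... | no  _   | yes (i , i<k , eq) = lower-rung i i<k eq
  ... | no  t≢m | no  ¬rung          = elsewhere t≢m (λ i i<k eq → ¬rung (i , i<k , eq))

  exponent : ℕ → ℕ
  exponent s = r * (A * (s C 2) + s * a)

  exponent-suc : ∀ s → exponent (suc s) ≡ exponent s + r * rung s
  exponent-suc s = trans (cong (λ c → r * (A * c + suc s * a)) [1+s]C2≡s+sC2)
    (solve 5 (λ r A a s c → r :* (A :* (s :+ c) :+ (a :+ s :* a)) := r :* (A :* c :+ s :* a) :+ r :* (s :* A :+ a))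
       refl r A a s (s C 2))
    where
    open ℕSolver.+-*-Solver
    [1+s]C2≡s+sC2 : suc s C 2 ≡ s + s C 2
    [1+s]C2≡s+sC2 = trans (sym (nCk+nC[k+1]≡[n+1]C[k+1] s 1)) (cong (_+ s C 2) (nC1≡n s))

  summand : ℕ → PS
  summand s = mono (exponent s) ⊛ invPoch A a s

  summand-⊛-tailFactor : ∀ s → (summand s ⊛ tailFactor r (rung s)) ≗ summand (suc s)
  summand-⊛-tailFactor s = begin
    (mono (exponent s) ⊛ invPoch A a s) ⊛ (mono (r * rung s) ⊛ geom -1ℤ (rung s))
      ≈⟨ ⊛-interchange (mono (exponent s)) (invPoch A a s) (mono (r * rung s)) (geom -1ℤ (rung s)) ⟩
    (mono (exponent s) ⊛ mono (r * rung s)) ⊛ (invPoch A a s ⊛ geom -1ℤ (rung s))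
      ≈⟨ ⊛-cong (≗-trans (mono-+ (exponent s) (r * rung s)) (λ n → cong (λ e → mono e n) (sym (exponent-suc s))))
                (λ n → cong (λ e → (invPoch A a s ⊛ geom -1ℤ e) n) (ℕₚ.+-comm (s * A) a)) ⟩
    mono (exponent (suc s)) ⊛ invPoch A a (suc s)
      ∎
    where open ≗-Reasoning

  summand-⊛-shortFactor : (summand k ⊛ quotaFactor r short m) ≗ bracket r A a k
  summand-⊛-shortFactor = begin
    summand k ⊛ (one ⊖ ((+ 2) · tailFactor r m))
      ≈⟨ ⊛-distribˡ-⊖ (summand k) one ((+ 2) · tailFactor r m) ⟩
    (summand k ⊛ one) ⊖ (summand k ⊛ ((+ 2) · tailFactor r m))
      ≈⟨ ⊖-cong (⊛-identityʳ (summand k))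
                (≗-trans (⊛-·ʳ (+ 2) (summand k) (tailFactor r m)) (·-congˡ (+ 2) (summand-⊛-tailFactor k))) ⟩
    summand k ⊖ ((+ 2) · summand (suc k))
      ∎
    where open ≗-Reasoning

  exponent-zero : exponent 0 ≡ 0
  exponent-zero = trans (cong (λ x → r * (x + 0)) (ℕₚ.*-zeroʳ A)) (ℕₚ.*-zeroʳ r)

  sizeFactor : ℕ → PS
  sizeFactor t = quotaFactor r (quota t) t

  partial : ℕ → PS
  partial N = prodBelow N (λ j → sizeFactor (suc j))

  -- s counts the rungs in [1, N]
  RungsUpTo : ℕ → ℕ → Set
  RungsUpTo N s = s ≤ k × (∀ i → i < k → (rung i ≤ N → i < s) × (i < s → rung i ≤ N))

  rungsUpTo-zero : RungsUpTo 0 0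
  rungsUpTo-zero = z≤n , λ i _ → (λ rung≤0 → ⊥-elim (ℕₚ.<-irrefl refl (ℕₚ.≤-trans 1≤a (ℕₚ.≤-trans (a≤rung i) rung≤0)))) , λ ()

  rungsUpTo-off : ∀ {N s} → RungsUpTo N s → (∀ i → i < k → rung i ≢ suc N) → RungsUpTo (suc N) s
  rungsUpTo-off (s≤k , counts) ¬rung = s≤k , λ i i<k →
    (λ rung≤1+N → proj₁ (counts i i<k) (ℕₚ.≤-pred (ℕₚ.≤∧≢⇒< rung≤1+N (¬rung i i<k)))) ,
    (λ i<s → ℕₚ.m≤n⇒m≤1+n (proj₂ (counts i i<k) i<s))

  rungsUpTo-on : ∀ {N s i} → RungsUpTo N s → i < k → rung i ≡ suc N → i ≡ s × RungsUpTo (suc N) (suc s)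
  rungsUpTo-on {N} {s} {i} (s≤k , counts) i<k rung-i≡1+N = i≡s , subst (λ x → suc x ≤ k) i≡s i<k , counts′
    where
    s≤i : s ≤ i
    s≤i = ℕₚ.≮⇒≥ (λ i<s → ℕₚ.<-irrefl rung-i≡1+N (s≤s (proj₂ (counts i i<k) i<s)))
    i≤s : i ≤ s
    i≤s = ℕₚ.≮⇒≥ λ s<i → ℕₚ.<-irrefl refl
      (proj₁ (counts s (ℕₚ.<-trans s<i i<k)) (ℕₚ.≤-pred (subst (rung s <_) rung-i≡1+N (rung-< s<i))))
    i≡s : i ≡ s
    i≡s = ℕₚ.≤-antisym i≤s s≤i
    counts′ : ∀ j → j < k → (rung j ≤ suc N → j < suc s) × (j < suc s → rung j ≤ suc N)
    counts′ j j<k = to , from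
      where
      to : rung j ≤ suc N → j < suc s
      to rung≤1+N with ℕₚ.m≤n⇒m<n∨m≡n rung≤1+N
      ... | inj₁ rung<1+N = ℕₚ.m<n⇒m<1+n (proj₁ (counts j j<k) (ℕₚ.≤-pred rung<1+N))
      ... | inj₂ rung≡1+N = s≤s (ℕₚ.≤-reflexive (trans (rung-injective (trans rung≡1+N (sym rung-i≡1+N))) i≡s))
      from : j < suc s → rung j ≤ suc N
      from (s≤s j≤s) with ℕₚ.m≤n⇒m<n∨m≡n j≤s
      ... | inj₁ j<s  = ℕₚ.m≤n⇒m≤1+n (proj₂ (counts j j<k) j<s)
      ... | inj₂ refl = ℕₚ.≤-reflexive (trans (cong rung (sym i≡s)) rung-i≡1+N)

  partial-below-m : ∀ N → N < m → ∃ λ s → RungsUpTo N s × partial N ≗ summand s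
  partial-below-m zero    _     = 0 , rungsUpTo-zero ,
    ≗-sym (≗-trans (⊛-identityʳ (mono (exponent 0))) (λ n → cong (λ e → mono e n) exponent-zero))
  partial-below-m (suc N) 1+N<m =
    let s , rungs , partialN≗ = partial-below-m N (ℕₚ.<-trans (ℕₚ.n<1+n N) 1+N<m) in
    extend (quota-view (suc N)) rungs partialN≗
    where
    extend : ∀ {q s} → QuotaView (suc N) q → RungsUpTo N s → partial N ≗ summand s →
      ∃ λ s′ → RungsUpTo (suc N) s′ × (partial N ⊛ quotaFactor r q (suc N)) ≗ summand s′
    extend (at-m 1+N≡m) _ _ = ⊥-elim (ℕₚ.<-irrefl 1+N≡m 1+N<m)
    extend {s = s} (lower-rung i i<k rung-i≡1+N) rungs partialN≗
      with refl , rungs′ ← rungsUpTo-on rungs i<k rung-i≡1+N =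
      suc s , rungs′ , ≗-trans (⊛-congʳ (tailFactor r (suc N)) partialN≗)
        (subst (λ t → (summand s ⊛ tailFactor r t) ≗ summand (suc s)) rung-i≡1+N (summand-⊛-tailFactor s))
    extend {s = s} (elsewhere _ ¬rung) rungs partialN≗ =
      s , rungsUpTo-off rungs ¬rung , ≗-trans (⊛-identityʳ (partial N)) partialN≗

  partial-m : ∀ M → suc M ≡ m → partial (suc M) ≗ bracket r A a k
  partial-m M 1+M≡m with s , (s≤k , counts) , partialM≗ ← partial-below-m M (ℕₚ.≤-reflexive 1+M≡m)
    = close (quota-view (suc M))
    where
    s≡k : s ≡ k
    s≡k = ℕₚ.≤-antisym s≤k (ℕₚ.≮⇒≥ λ s<k → ℕₚ.<-irrefl refl
      (proj₁ (counts s s<k) (ℕₚ.≤-pred (subst (rung s <_) (sym 1+M≡m) (rung-< s<k)))))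
    close : ∀ {q} → QuotaView (suc M) q → (partial M ⊛ quotaFactor r q (suc M)) ≗ bracket r A a k
    close (at-m _) = begin
      partial M ⊛ quotaFactor r short (suc M)   ≈⟨ ⊛-congʳ (quotaFactor r short (suc M)) partialM≗ ⟩
      summand s ⊛ quotaFactor r short (suc M)   ≡⟨ cong₂ (λ s t → summand s ⊛ quotaFactor r short t) s≡k 1+M≡m ⟩
      summand k ⊛ quotaFactor r short m         ≈⟨ summand-⊛-shortFactor ⟩
      bracket r A a k                           ∎
      where open ≗-Reasoning
    close (lower-rung i i<k rung-i≡1+M) = ⊥-elim (ℕₚ.<-irrefl (rung-injective (trans rung-i≡1+M 1+M≡m)) i<k)
    close (elsewhere 1+M≢m _) = ⊥-elim (1+M≢m 1+M≡m)

  free-above-m : ∀ j → m ≤ j → sizeFactor (suc j) ≗ one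
  free-above-m j m≤j = trivial (quota-view (suc j))
    where
    trivial : ∀ {q} → QuotaView (suc j) q → quotaFactor r q (suc j) ≗ one
    trivial (at-m 1+j≡m) = ⊥-elim (ℕₚ.<-irrefl (sym 1+j≡m) (s≤s m≤j))
    trivial (lower-rung i i<k rung-i≡1+j) = ⊥-elim (ℕₚ.<-irrefl rung-i≡1+j
      (ℕₚ.<-trans (rung-< i<k) (s≤s m≤j)))
    trivial (elsewhere _ _) = ≗-refl

  partial≗bracket : ∀ d → partial (m + d) ≗ bracket r A a k
  partial≗bracket d = ≗-trans (prodBelow-one m d (λ j → sizeFactor (suc j)) free-above-m)
    (λ n → trans (cong (λ N → partial N n) m≡1+pred) (partial-m (ℕ.pred m) (sym m≡1+pred) n))
    where
    m≡1+pred : m ≡ suc (ℕ.pred m)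
    m≡1+pred = sym (ℕₚ.suc-pred m {{ℕ.>-nonZero (ℕₚ.≤-trans 1≤a (a≤rung k))}})

  rung-mono-≤ : ∀ {i j} → i ≤ j → rung i ≤ rung j
  rung-mono-≤ i≤j = ℕₚ.+-monoˡ-≤ a (ℕₚ.*-monoˡ-≤ A i≤j)

  below-m⇒lower-rung : ∀ t → 1 ≤ t → CongMod A t a → t < m → ∃ λ i → i < k × rung i ≡ t
  below-m⇒lower-rung t 1≤t t≡a t<m =
    let i , rung-i≡t = congMod⇒+ A a 1≤a a≤A t 1≤t t≡a in
    i , ℕₚ.≰⇒> (λ k≤i → ℕₚ.<⇒≱ t<m (subst (m ≤_) rung-i≡t (rung-mono-≤ k≤i))) , rung-i≡t

  meets-full : ∀ {t q π} → QuotaView t q → ∀ i → i < k → rung i ≡ t → Meets r q t π → Meets r full t π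
  meets-full (at-m t≡m)          i i<k rung-i≡t _     = ⊥-elim (ℕₚ.<-irrefl (rung-injective (trans rung-i≡t t≡m)) i<k)
  meets-full (lower-rung _ _ _)  _ _   _        meets = meets
  meets-full (elsewhere _ ¬rung) i i<k rung-i≡t _     = ⊥-elim (¬rung i i<k rung-i≡t)

  meets-short : ∀ {q π} → QuotaView m q → Meets r q m π → Meets r short m π
  meets-short (at-m _)                  meets = meets
  meets-short (lower-rung i i<k rung-i≡m) _   = ⊥-elim (ℕₚ.<-irrefl (rung-injective rung-i≡m) i<k)
  meets-short (elsewhere m≢m _)         _     = ⊥-elim (m≢m refl)

  admissible⇒mes : ∀ {N π} → m ≤ N → Admissible r quota N π → IsMes r A a π m × NmesCond A a π m
  admissible⇒mes {N} {π} m≤N ((parts>0 , _) , _ , meets) =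
    (1≤m , congMod-+ A a k , meets-short (quota-view m) (meets m 1≤m m≤N) , λ m′ 1≤m′ m′≡a m′<m → proj₁ (full-below m′ 1≤m′ m′≡a m′<m)) ,
    not-overlined
    where
    1≤m : 1 ≤ m
    1≤m = ℕₚ.≤-trans 1≤a (a≤rung k)
    full-below : ∀ t → 1 ≤ t → CongMod A t a → t < m → Meets r full t π
    full-below t 1≤t t≡a t<m =
      let i , i<k , rung-i≡t = below-m⇒lower-rung t 1≤t t≡a t<m in
      meets-full (quota-view t) i i<k rung-i≡t (meets t 1≤t (ℕₚ.≤-trans (ℕₚ.<⇒≤ t<m) m≤N))
    not-overlined : NmesCond A a π m
    not-overlined (t , false) _  _   _   = refl
    not-overlined (t , true)  p∈ t≡a t<m = ⊥-elim (proj₂ (full-below t (All.lookup parts>0 p∈) t≡a t<m) p∈)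

  mes⇒admissible : ∀ {N π} → IsOverpartition π → All (λ p → proj₁ p ≤ N) π →
    IsMes r A a π m → NmesCond A a π m → Admissible r quota N π
  mes⇒admissible {π = π} op π≤N (_ , _ , count<r , minimal) not-overlined = op , π≤N , λ t _ _ → meets-of (quota-view t)
    where
    meets-of : ∀ {t q} → QuotaView t q → Meets r q t π
    meets-of (at-m t≡m) = subst (λ t → count π t < r) (sym t≡m) count<r
    meets-of (lower-rung i i<k refl) =
      minimal (rung i) (ℕₚ.≤-trans 1≤a (a≤rung i)) (congMod-+ A a i) (rung-< i<k) ,
      λ ov∈ → case not-overlined (rung i , true) ov∈ (congMod-+ A a i) (rung-< i<k) of λ ()
    meets-of (elsewhere _ _) = tt

  length-admissible≡ : ∀ n → + length (admissible r quota (m + n) n) ≡ (overGF ⊛ bracket r A a k) n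
  length-admissible≡ n = begin
      + length (admissible r quota (m + n) n)
    ≡⟨ length-admissible r quota (m + n) n ⟩
      prodBelow (m + n) (λ j → blockCounts r quota (suc j)) n
    ≡⟨ prodBelow-cong (m + n) (λ j _ → blockCounts≗ r 1≤r quota (suc j)) n ⟩
      prodBelow (m + n) (λ j → overFactor (suc j) ⊛ sizeFactor (suc j)) n
    ≡⟨ prodBelow-⊛ (m + n) (λ j → overFactor (suc j)) (λ j → sizeFactor (suc j)) n ⟩
      (prodBelow (m + n) (λ j → overFactor (suc j)) ⊛ partial (m + n)) n
    ≡⟨ sumBelow-cong (suc n) (λ i i<1+n → cong₂ ℤ._*_
         (overGF-coeff (m + n) i (ℕₚ.≤-trans (ℕₚ.≤-pred i<1+n) (ℕₚ.m≤n+m n m)))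
         (partial≗bracket n (n ∸ i))) ⟩
      (overGF ⊛ bracket r A a k) n
    ∎
    where open ≡-Reasoning

  ∈-admissible⇔ : ∀ n π → (π ∈ admissible r quota (m + n) n) ⇔
    (IsOverpartition π × weight π ≡ n × IsMes r A a π m × NmesCond A a π m)
  ∈-admissible⇔ n π = mk⇔
    (λ π∈ → let adm , weight≡n = admissible-sound r quota (m + n) n π∈ in
            proj₁ adm , weight≡n , admissible⇒mes (ℕₚ.m≤m+n m n) adm)
    (λ (op , weight≡n , mes , not-overlined) → admissible-complete r quota (m + n) n π
       (mes⇒admissible op (All.map (λ p≤w → ℕₚ.≤-trans p≤w (ℕₚ.≤-trans (ℕₚ.≤-reflexive weight≡n) (ℕₚ.m≤n+m n m)))
                                   (parts-≤-weight π)) mes not-overlined)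
       weight≡n)

m≤m*n+o : ∀ m n o .{{_ : NonZero n}} → m ≤ m * n + o
m≤m*n+o m n o = ℕₚ.≤-trans (ℕₚ.m≤m*n m n) (ℕₚ.m≤m+n (m * n) o)

rhsCoeff-rung : ∀ r A a k n .{{_ : NonZero A}} → rhsCoeff r A a (k * A + a) n ≡ (overGF ⊛ bracket r A a k) n
rhsCoeff-rung r A a k n = sumBelow-if-unique (suc (k * A + a)) (λ k′ → k′ * A + a ≡ᵇ k * A + a)
  (λ k′ → (overGF ⊛ bracket r A a k′) n) k
  (s≤s (m≤m*n+o k A a)) (≡⇒≡ᵇ-true {k * A + a} refl)
  (λ i _ eq → ℕₚ.*-cancelʳ-≡ i k A (ℕₚ.+-cancelʳ-≡ a (i * A) (k * A) (≡ᵇ-true⇒≡ eq)))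

rhsCoeff-non-rung : ∀ r A a m n → (∀ k → k < suc m → k * A + a ≢ m) → rhsCoeff r A a m n ≡ 0ℤ
rhsCoeff-non-rung r A a m n ¬rung =
  sumBelow-if-none (suc m) (λ k → k * A + a ≡ᵇ m) _ (λ k k<1+m → ≢⇒≡ᵇ-false (¬rung k k<1+m))

theorem2p3 : (A a r : ℕ) → 1 ≤ a → a ≤ A → 1 ≤ r →
    (m n : ℕ) →
    ∃ λ (L : List (List Part)) →
      Unique L ×
      (∀ π → (π ∈ L) ⇔ (IsOverpartition π × weight π ≡ n ×
                         IsMes r A a π m × NmesCond A a π m)) ×
      + (length L) ≡ rhsCoeff r A a m n
theorem2p3 A a r 1≤a a≤A 1≤r m n with ℕₚ.anyUpTo? (λ k → k * A + a ≟ m) (suc m)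
... | yes (k , _ , refl) =
  admissible r quota (m + n) n , admissible-unique r quota (m + n) n , ∈-admissible⇔ n ,
  trans (length-admissible≡ n) (sym (rhsCoeff-rung r A a k n))
  where open Rungs A a r k 1≤a a≤A 1≤r hiding (m)
... | no ¬rung =
  [] , [] , (λ π → mk⇔ (λ ()) (λ (_ , _ , (1≤m , m≡a , _) , _) → ⊥-elim (no-mes 1≤m m≡a))) ,
  sym (rhsCoeff-non-rung r A a m n (λ k k<1+m eq → ¬rung (k , k<1+m , eq)))
  where
  no-mes : 1 ≤ m → CongMod A m a → ⊥
  no-mes 1≤m m≡a = let k , rung≡m = congMod⇒+ A a 1≤a a≤A m 1≤m m≡a in
    ¬rung (k , s≤s (subst (k ≤_) rung≡m (m≤m*n+o k A a {{ℕ.>-nonZero (ℕₚ.≤-trans 1≤a a≤A)}})) , rung≡m)
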